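{- Let $G=\langle a,b\mid a^m=b^n=1,\ b^{ -1}ab=a^r\rangle$ be a group of odd order all of whose Sylow subgroups are cyclic, where $r\not\equiv 1\pmod m$ and $r^n\equiv 1\pmod m$. Let $n_0$ be the smallest positive integer such that $r^{n_0}\equiv 1\pmod m$. Suppose further that $G$ is not a direct product of any two non-trivial subgroups. Then a map $\sigma$ is an automorphism of $G$ if and only if it is the homomorphism determined by \[a\mapsto a^s,\qquad b\mapsto a^tb^{1+ln_0},\] for some integers $s,t,l$ with $1\le s<m$, $\gcd(s,m)=1$, $0\le l<n/n_0$ and $1\le t\le m$. In particular, for every $j$ with $\gcd(j,n)=1$ and all integers $t,l$, the element $b^j$ is mapped to $a^tb^{j+ln_0}$ by some automorphism of $G$; and for every $b^i\notin Z(G)$, no automorphism of $G$ maps $b^i$ to $b^{ -i}$.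
   Context: $Z(G)$ denotes the centre of $G$. Here $a$ has order $m$ and $b$ has order $n$. -}

module Defs where

open import Data.Nat as ℕ using (ℕ; zero; suc; _∸_; NonZero)
open import Data.Integer as ℤ using (ℤ; +_; -[1+_]; _%ℕ_)
open import Data.Product using (Σ; ∃; _×_; _,_; proj₁; proj₂)
open import Data.Empty using (⊥)
open import Relation.Nullary using (¬_)
open import Relation.Binary.PropositionalEquality using (_≡_)

-- Concrete model of the metacyclic group
--   G = ⟨ a , b ∣ a^m = b^n = 1 , b⁻¹ a b = a^r ⟩      (r^n ≡ 1 mod m).
-- A pair (j , i) : ℕ × ℤ stands for the normal form  b^j a^i.
-- From a^i b^k = b^k (b^{-k} a^i b^k) = b^k a^{i r^k} we get
--   (b^j a^i)(b^k a^l) = b^{j+k} a^{i r^k + l}.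
-- Equality is "j ≡ j' mod n and i ≡ i' mod m" (a setoid), so the group
-- has exactly m·n elements; a has order m and b has order n.
module Meta (m n r : ℕ) .{{_ : NonZero m}} .{{_ : NonZero n}} where

  Carrier : Set
  Carrier = ℕ × ℤ

  infix 4 _≈_
  _≈_ : Carrier → Carrier → Set
  (j , i) ≈ (j' , i') = (j ℕ.% n ≡ j' ℕ.% n) × (i %ℕ m ≡ i' %ℕ m)

  infixl 7 _∙_
  _∙_ : Carrier → Carrier → Carrier
  (j , i) ∙ (k , l) = (j ℕ.+ k , i ℤ.* (+ (r ℕ.^ k)) ℤ.+ l)

  e : Carrier
  e = (0 , + 0)

  _⁻¹ : Carrier → Carrier
  (j , i) ⁻¹ = ((n ∸ 1) ℕ.* j , ℤ.- (i ℤ.* (+ (r ℕ.^ ((n ∸ 1) ℕ.* j)))))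

  a : Carrier
  a = (0 , + 1)

  b : Carrier
  b = (1 , + 0)

  pow : Carrier → ℕ → Carrier
  pow g zero = e
  pow g (suc k) = g ∙ pow g k

  powℤ : Carrier → ℤ → Carrier
  powℤ g (+ k) = pow g k
  powℤ g -[1+ k ] = pow (g ⁻¹) (suc k)

  order : ℕ
  order = m ℕ.* n

  InCentre : Carrier → Set
  InCentre x = ∀ g → x ∙ g ≈ g ∙ x

  record IsHom (σ : Carrier → Carrier) : Set where
    field
      cong : ∀ {x y} → x ≈ y → σ x ≈ σ y
      hom  : ∀ x y → σ (x ∙ y) ≈ σ x ∙ σ y

  record IsAut (σ : Carrier → Carrier) : Set where
    field
      isHom      : IsHom σ
      injective  : ∀ {x y} → σ x ≈ σ y → x ≈ y
      surjective : ∀ y → ∃ λ x → σ x ≈ y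

  record Subgroup : Set₁ where
    field
      P        : Carrier → Set
      resp     : ∀ {x y} → x ≈ y → P x → P y
      has-e    : P e
      closed-∙ : ∀ {x y} → P x → P y → P (x ∙ y)
      closed-⁻¹ : ∀ {x} → P x → P (x ⁻¹)
  open Subgroup public

  _⊆_ : Subgroup → Subgroup → Set
  H ⊆ K = ∀ x → P H x → P K x

  IsPSubgroup : ℕ → Subgroup → Set
  IsPSubgroup p H = ∀ x → P H x → ∃ λ k → pow x (p ℕ.^ k) ≈ e

  IsSylow : ℕ → Subgroup → Set₁
  IsSylow p H = IsPSubgroup p H × (∀ K → IsPSubgroup p K → H ⊆ K → K ⊆ H)

  IsCyclic : Subgroup → Set
  IsCyclic H = Σ Carrier λ g → P H g × (∀ h → P H h → ∃ λ k → h ≈ pow g k)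

  IsNormal : Subgroup → Set
  IsNormal H = ∀ g x → P H x → P H (g ∙ x ∙ g ⁻¹)

  NonTrivial : Subgroup → Set
  NonTrivial H = ∃ λ x → P H x × ¬ (x ≈ e)

  IsDirectProductOf : Subgroup → Subgroup → Set
  IsDirectProductOf H K =
    IsNormal H × IsNormal K × (∀ x → P H x → P K x → x ≈ e)
    × (∀ g → ∃ λ h → ∃ λ k → P H h × P K k × g ≈ h ∙ k)

  NotDirectProduct : Set₁
  NotDirectProduct =
    ∀ H K → NonTrivial H → NonTrivial K → ¬ IsDirectProductOf H K

{-# OPTIONS --safe #-}
module Submission where

-- If a prime p divided both m and r − 1, then either p ∣ n and the Sylow
-- p-subgroup ⟨b^{n′}, a^{m′}⟩ (n′, m′ the p′-parts of n, m) is not cyclic, or p ∤ n and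
-- G = ⟨a^{m′}⟩ × ⟨b, a^{p^μ}⟩. Likewise a prime q ∣ n with q ∤ n₀ would make the Sylow q-subgroup
-- non-cyclic or split G = ⟨b^{n′}⟩ × ⟨b^{q^ν}, a⟩. So r − 1 is a unit mod m, and 1 + l n₀ is a
-- unit mod n. Applying an automorphism σ to a b = b a^r then shows σ(a) = a^s, s a unit, and
-- r^K ≡ r for the b-exponent K of σ(b), i.e. K = 1 + l n₀; conversely these data always define a
-- bijective endomorphism. Finally, σ(b^i) = b^{-i} forces 2i ≡ 0 (mod n₀), so i ≡ 0 as |G| is odd,
-- and b^i is central.

open import Data.Nat using (ℕ; NonZero; _^_)
open import Data.Integer using (ℤ; +_)

module Congruence where

  open import Data.Nat as ℕ using (ℕ; zero; suc; NonZero)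
  import Data.Nat.Properties as ℕP
  open import Data.Nat.Divisibility as ℕD using (_∣_; divides)
  open import Data.Nat.Coprimality as ℕC using (Coprime)
  import Data.Nat.GCD as GCD
  open import Data.Integer using (ℤ; +_; -[1+_]; _%ℕ_; _/ℕ_; ∣_∣; _+_; _*_; -_; _-_)
  import Data.Integer.Properties as ℤP
  import Data.Integer.DivMod as ℤD
  open import Data.Integer.Tactic.RingSolver using (solve-∀)
  open import Data.Product using (Σ; ∃; _×_; _,_)
  open import Data.Empty using (⊥-elim)
  open import Level using (0ℓ)
  open import Relation.Binary.Bundles using (Setoid)
  open import Relation.Binary.PropositionalEquality
    using (_≡_; refl; sym; trans; cong; cong₂; subst; module ≡-Reasoning)
  import Relation.Binary.Reasoning.Setoid as SetoidReasoning

  infix 4 _≡_[mod_]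

  record _≡_[mod_] (x y : ℤ) (d : ℕ) : Set where
    constructor by-multiple
    field
      multiple : ℤ
      equation : x ≡ y + multiple * + d

  module _ {d : ℕ} where

    mod-refl : ∀ {x} → x ≡ x [mod d ]
    mod-refl {x} = by-multiple (+ 0) (sym (trans (cong (_+_ x) (ℤP.*-zeroˡ (+ d))) (ℤP.+-identityʳ x)))

    mod-reflexive : ∀ {x y} → x ≡ y → x ≡ y [mod d ]
    mod-reflexive refl = mod-refl

    mod-sym : ∀ {x y} → x ≡ y [mod d ] → y ≡ x [mod d ]
    mod-sym {y = y} (by-multiple k refl) = by-multiple (- k) (l y k (+ d))
      where
      l : ∀ y k d → y ≡ (y + k * d) + (- k) * d
      l = solve-∀

    mod-trans : ∀ {x y z} → x ≡ y [mod d ] → y ≡ z [mod d ] → x ≡ z [mod d ]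
    mod-trans {z = z} (by-multiple k refl) (by-multiple k′ refl) = by-multiple (k + k′) (l z k k′ (+ d))
      where
      l : ∀ z k k′ d → (z + k′ * d) + k * d ≡ z + (k + k′) * d
      l = solve-∀

    mod-respˡ : ∀ {x x′ y} → x ≡ x′ → x ≡ y [mod d ] → x′ ≡ y [mod d ]
    mod-respˡ refl p = p

    mod-respʳ : ∀ {x y y′} → y ≡ y′ → x ≡ y [mod d ] → x ≡ y′ [mod d ]
    mod-respʳ refl p = p

    mod-+ : ∀ {x x′ y y′} → x ≡ x′ [mod d ] → y ≡ y′ [mod d ] → x + y ≡ x′ + y′ [mod d ]
    mod-+ {x′ = x′} {y′ = y′} (by-multiple k refl) (by-multiple k′ refl) =
      by-multiple (k + k′) (l x′ y′ k k′ (+ d))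
      where
      l : ∀ x y k k′ d → (x + k * d) + (y + k′ * d) ≡ (x + y) + (k + k′) * d
      l = solve-∀

    mod-* : ∀ {x x′ y y′} → x ≡ x′ [mod d ] → y ≡ y′ [mod d ] → x * y ≡ x′ * y′ [mod d ]
    mod-* {x′ = x′} {y′ = y′} (by-multiple k refl) (by-multiple k′ refl) =
      by-multiple (k * y′ + x′ * k′ + k * k′ * + d) (l x′ y′ k k′ (+ d))
      where
      l : ∀ x y k k′ d → (x + k * d) * (y + k′ * d) ≡ x * y + (k * y + x * k′ + k * k′ * d) * d
      l = solve-∀

    mod-neg : ∀ {x y} → x ≡ y [mod d ] → - x ≡ - y [mod d ]
    mod-neg {y = y} (by-multiple k refl) = by-multiple (- k) (l y k (+ d))
      where
      l : ∀ y k d → - (y + k * d) ≡ - y + (- k) * d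
      l = solve-∀

    mod-*ˡ : ∀ {x y} c → x ≡ y [mod d ] → c * x ≡ c * y [mod d ]
    mod-*ˡ c p = mod-* (mod-refl {c}) p

    mod-*ʳ : ∀ {x y} c → x ≡ y [mod d ] → x * c ≡ y * c [mod d ]
    mod-*ʳ c p = mod-* p mod-refl

    mod-+-cancelʳ : ∀ {x y} c → x + c ≡ y + c [mod d ] → x ≡ y [mod d ]
    mod-+-cancelʳ {x} {y} c p = mod-respˡ (l x c) (mod-respʳ (l y c) (mod-+ p (mod-refl { - c})))
      where
      l : ∀ x c → x + c + - c ≡ x
      l = solve-∀

    mod-+-cancelˡ : ∀ {c c′ x y} → c ≡ c′ [mod d ] → c + x ≡ c′ + y [mod d ] → x ≡ y [mod d ]
    mod-+-cancelˡ {c} {c′} {x} {y} q p = mod-respˡ (l c x) (mod-respʳ (l c′ y) (mod-+ p (mod-neg q)))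
      where
      l : ∀ c x → c + x + - c ≡ x
      l = solve-∀

  ≡0-*-≡0 : ∀ {a b x y} → x ≡ + 0 [mod a ] → y ≡ + 0 [mod b ] → x * y ≡ + 0 [mod a ℕ.* b ]
  ≡0-*-≡0 {a} {b} (by-multiple k refl) (by-multiple k′ refl) =
    by-multiple (k * k′) (trans (l k k′ (+ a) (+ b)) (cong (λ z → + 0 + k * k′ * z) (sym (ℤP.pos-* a b))))
    where
    l : ∀ k k′ a b → (+ 0 + k * a) * (+ 0 + k′ * b) ≡ + 0 + k * k′ * (a * b)
    l = solve-∀

  mod-setoid : ℕ → Setoid 0ℓ 0ℓ
  mod-setoid d = record
    { Carrier = ℤ
    ; _≈_ = _≡_[mod d ]
    ; isEquivalence = record { refl = mod-refl ; sym = mod-sym ; trans = mod-trans }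
    }

  module mod-Reasoning (d : ℕ) = SetoidReasoning (mod-setoid d)

  mod-1 : ∀ x y → x ≡ y [mod 1 ]
  mod-1 x y = by-multiple (x - y) (l x y)
    where
    l : ∀ x y → x ≡ y + (x - y) * + 1
    l = solve-∀

  mod-∣ : ∀ {d e x y} → e ∣ d → x ≡ y [mod d ] → x ≡ y [mod e ]
  mod-∣ {e = e} {y = y} (divides q refl) (by-multiple k refl) =
    by-multiple (k * + q) (cong (_+_ y) (trans (cong (k *_) (ℤP.pos-* q e)) (sym (ℤP.*-assoc k (+ q) (+ e)))))

  ∣⇒≡0 : ∀ {d j} → d ∣ j → + j ≡ + 0 [mod d ]
  ∣⇒≡0 {d} (divides q refl) = by-multiple (+ q) (trans (ℤP.pos-* q d) (sym (ℤP.+-identityˡ _)))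

  ≡0⇒∣ : ∀ {d x} → x ≡ + 0 [mod d ] → d ∣ ∣ x ∣
  ≡0⇒∣ {d} (by-multiple k refl) = divides ∣ k ∣ (trans (cong ∣_∣ (ℤP.+-identityˡ (k * + d))) (ℤP.abs-* k (+ d)))

  ∣∸1⇒≡1 : ∀ {d x} → 1 ℕ.≤ x → d ∣ x ℕ.∸ 1 → + x ≡ + 1 [mod d ]
  ∣∸1⇒≡1 {x = suc x} _ d∣x = mod-respˡ (sym (ℤP.pos-+ 1 x)) (mod-respʳ (ℤP.+-identityʳ (+ 1)) (mod-+ (mod-refl {x = + 1}) (∣⇒≡0 d∣x)))

  mod-/ : ∀ {c d x y} .{{_ : NonZero c}} → x * + c ≡ y * + c [mod d ℕ.* c ] → x ≡ y [mod d ]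
  mod-/ {c} {d} {x} {y} (by-multiple k eq) = by-multiple k (ℤP.*-cancelʳ-≡ x (y + k * + d) (+ c) (begin
    x * + c                  ≡⟨ eq ⟩
    y * + c + k * + (d ℕ.* c) ≡⟨ cong (λ z → y * + c + k * z) (ℤP.pos-* d c) ⟩
    y * + c + k * (+ d * + c) ≡⟨ l y (+ c) k (+ d) ⟩
    (y + k * + d) * + c      ∎))
    where
    open ≡-Reasoning
    l : ∀ y c k d → y * c + k * (d * c) ≡ (y + k * d) * c
    l = solve-∀

  module _ (d : ℕ) .{{_ : NonZero d}} where

    mod-%ℕ : ∀ x → x ≡ + (x %ℕ d) [mod d ]
    mod-%ℕ x = by-multiple (x /ℕ d) (ℤD.a≡a%ℕn+[a/ℕn]*n x d)

    %ℕ≡⇒mod : ∀ {x y} → x %ℕ d ≡ y %ℕ d → x ≡ y [mod d ]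
    %ℕ≡⇒mod {x} {y} eq = mod-trans (mod-%ℕ x) (mod-trans (mod-reflexive (cong +_ eq)) (mod-sym (mod-%ℕ y)))

    mod⇒%ℕ≡ : ∀ {x y} → x ≡ y [mod d ] → x %ℕ d ≡ y %ℕ d
    mod⇒%ℕ≡ {x} {y} p with mod-trans (mod-sym (mod-%ℕ x)) (mod-trans p (mod-%ℕ y))
    ... | by-multiple k eq = remainder-unique k (ℤD.n%ℕd<d x d) (ℤD.n%ℕd<d y d) eq
      where
      pos-eq : ∀ a b c → + a ≡ + b + + c * + d → a ≡ b ℕ.+ c ℕ.* d
      pos-eq a b c eq = ℤP.+-injective (trans eq
        (trans (cong (_+_ (+ b)) (sym (ℤP.pos-* c d))) (sym (ℤP.pos-+ b (c ℕ.* d)))))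

      d≤b+[1+c]d : ∀ b c → d ℕ.≤ b ℕ.+ suc c ℕ.* d
      d≤b+[1+c]d b c = ℕP.≤-trans (ℕP.m≤m+n d (c ℕ.* d)) (ℕP.m≤n+m _ b)

      remainder-unique : ∀ {a b} k → a ℕ.< d → b ℕ.< d → + a ≡ + b + k * + d → a ≡ b
      remainder-unique {a} {b} (+ zero) a<d b<d eq = trans (pos-eq a b 0 eq) (ℕP.+-identityʳ b)
      remainder-unique {a} {b} (+ suc c) a<d b<d eq =
        ⊥-elim (ℕP.<⇒≱ a<d (subst (d ℕ.≤_) (sym (pos-eq a b (suc c) eq)) (d≤b+[1+c]d b c)))
      remainder-unique {a} {b} -[1+ c ] a<d b<d eq =
        ⊥-elim (ℕP.<⇒≱ b<d (subst (d ℕ.≤_) (sym (pos-eq b a (suc c) (swap {C = + suc c} eq))) (d≤b+[1+c]d a c)))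
        where
        swap : ∀ {A B C} → A ≡ B + (- C) * + d → B ≡ A + C * + d
        swap {A} {B} {C} eq = trans (l B C (+ d)) (cong (_+ C * + d) (sym eq))
          where
          l : ∀ B C D → B ≡ (B + (- C) * D) + C * D
          l = solve-∀

  Invertible : ℕ → ℤ → Set
  Invertible d u = ∃ λ v → v * u ≡ + 1 [mod d ]

  module _ {d : ℕ} where

    invertible-cancelʳ : ∀ {u x y} → Invertible d u → x * u ≡ y * u [mod d ] → x ≡ y [mod d ]
    invertible-cancelʳ {u} {x} {y} (v , vu≡1) p = begin
      x                ≈⟨ mod-respʳ (ℤP.*-identityʳ x) (mod-*ˡ x vu≡1) ⟨
      x * (v * u)      ≡⟨ l x v u ⟩
      v * (x * u)      ≈⟨ mod-*ˡ v p ⟩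
      v * (y * u)      ≡⟨ l v y u ⟩
      y * (v * u)      ≈⟨ mod-respʳ (ℤP.*-identityʳ y) (mod-*ˡ y vu≡1) ⟩
      y                ∎
      where
      open mod-Reasoning d
      l : ∀ x v u → x * (v * u) ≡ v * (x * u)
      l = solve-∀

    invertible-cancel-≡0 : ∀ {u x} → Invertible d u → x * u ≡ + 0 [mod d ] → x ≡ + 0 [mod d ]
    invertible-cancel-≡0 {u} U p = invertible-cancelʳ U (mod-respʳ (sym (ℤP.*-zeroˡ u)) p)

    invertible-* : ∀ {u y} → Invertible d u → Invertible d y → Invertible d (u * y)
    invertible-* {u} {y} (v , p) (w , q) = v * w , mod-respˡ (l v u w y) (mod-* p q)
      where
      l : ∀ v u w y → (v * u) * (w * y) ≡ (v * w) * (u * y)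
      l = solve-∀

    invertible-resp : ∀ {u u′} → u ≡ u′ [mod d ] → Invertible d u → Invertible d u′
    invertible-resp p (v , q) = v , mod-trans (mod-*ˡ v (mod-sym p)) q

    invertible-^ : ∀ {x} k → Invertible d (+ x) → Invertible d (+ (x ℕ.^ k))
    invertible-^ zero U = + 1 , mod-refl
    invertible-^ {x} (suc k) U =
      subst (Invertible d) (sym (ℤP.pos-* x (x ℕ.^ k))) (invertible-* U (invertible-^ k U))

    invertible-∣∣ : ∀ x → Invertible d (+ ∣ x ∣) → Invertible d x
    invertible-∣∣ (+ k) U = U
    invertible-∣∣ -[1+ k ] (v , p) = - v , mod-respˡ (l v (+ suc k)) p
      where
      l : ∀ v x → v * x ≡ (- v) * (- x)
      l = solve-∀

  coprime-annihilators⇒≡0 : ∀ {d M c k} → Invertible M c → c * k ≡ + 0 [mod d ] → + M * k ≡ + 0 [mod d ] → k ≡ + 0 [mod d ]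
  coprime-annihilators⇒≡0 {d} {M} {c} {k} (x , by-multiple T xc≡1+TM) ck≡0 Mk≡0 = begin
    k                               ≡⟨ l k T (+ M) ⟩
    (+ 1 + T * + M) * k - T * (+ M * k) ≡⟨ cong (λ z → z * k - T * (+ M * k)) xc≡1+TM ⟨
    x * c * k - T * (+ M * k)       ≡⟨ cong (_- T * (+ M * k)) (ℤP.*-assoc x c k) ⟩
    x * (c * k) - T * (+ M * k)     ≈⟨ mod-+ (mod-*ˡ x ck≡0) (mod-neg (mod-*ˡ T Mk≡0)) ⟩
    x * + 0 - T * + 0               ≡⟨ l′ x T ⟩
    + 0                             ∎
    where
    open mod-Reasoning d
    l : ∀ k T M → k ≡ (+ 1 + T * M) * k - T * (M * k)
    l = solve-∀
    l′ : ∀ x T → x * + 0 - T * + 0 ≡ + 0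
    l′ = solve-∀

  invertible-∣ : ∀ {d e u} → e ∣ d → Invertible d u → Invertible e u
  invertible-∣ e∣d (v , p) = v , mod-∣ e∣d p

  invertible-mod-1 : ∀ u → Invertible 1 u
  invertible-mod-1 u = + 0 , mod-1 _ _

  coprime⇒invertible : ∀ {a d} → Coprime a d → Invertible d (+ a)
  coprime⇒invertible {a} {d} c with ℕC.coprime-Bézout c
  ... | GCD.Bézout.+- x y eq = + x , by-multiple (+ y) (begin
    + x * + a          ≡⟨ ℤP.pos-* x a ⟨
    + (x ℕ.* a)        ≡⟨ cong +_ eq ⟨
    + (1 ℕ.+ y ℕ.* d)  ≡⟨ ℤP.pos-+ 1 (y ℕ.* d) ⟩
    + 1 + + (y ℕ.* d)  ≡⟨ cong (_+_ (+ 1)) (ℤP.pos-* y d) ⟩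
    + 1 + + y * + d    ∎)
    where open ≡-Reasoning
  ... | GCD.Bézout.-+ x y eq = - + x , by-multiple (- + y) (begin
    (- + x) * + a          ≡⟨ l (+ x) (+ a) ⟩
    + 1 + - (+ 1 + + x * + a) ≡⟨ cong (λ z → + 1 + - z) (begin
      + 1 + + x * + a      ≡⟨ cong (_+_ (+ 1)) (ℤP.pos-* x a) ⟨
      + 1 + + (x ℕ.* a)    ≡⟨ ℤP.pos-+ 1 (x ℕ.* a) ⟨
      + (1 ℕ.+ x ℕ.* a)    ≡⟨ cong +_ eq ⟩
      + (y ℕ.* d)          ≡⟨ ℤP.pos-* y d ⟩
      + y * + d            ∎) ⟩
    + 1 + - (+ y * + d)    ≡⟨ cong (_+_ (+ 1)) (ℤP.neg-distribˡ-* (+ y) (+ d)) ⟩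
    + 1 + (- + y) * + d    ∎)
    where
    open ≡-Reasoning
    l : ∀ x a → (- x) * a ≡ + 1 + - (+ 1 + x * a)
    l = solve-∀

  ∃-representative-1…d : ∀ d .{{_ : NonZero d}} x → ∃ λ t → 1 ℕ.≤ t × t ℕ.≤ d × + t ≡ x [mod d ]
  ∃-representative-1…d d x with x %ℕ d in x%d≡ | ℤD.n%ℕd<d x d
  ... | zero  | _   = d , ℕP.n≢0⇒n>0 (ℕ.≢-nonZero⁻¹ d) , ℕP.≤-refl ,
                      mod-trans (∣⇒≡0 ℕD.∣-refl) (mod-trans (mod-reflexive (cong +_ (sym x%d≡))) (mod-sym (mod-%ℕ d x)))
  ... | suc t | t<d = suc t , ℕ.s≤s ℕ.z≤n , ℕP.<⇒≤ t<d , mod-trans (mod-reflexive (cong +_ (sym x%d≡))) (mod-sym (mod-%ℕ d x))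

  ≡0-mod-* : ∀ {B D i} → Invertible D (+ B) → i ≡ + 0 [mod B ] → i ≡ + 0 [mod D ] → i ≡ + 0 [mod B ℕ.* D ]
  ≡0-mod-* {B} {D} {i} (v , by-multiple w vB≡1+wD) (by-multiple u i≡uB) (by-multiple u′ i≡u′D) =
    by-multiple (u′ * v - u * w) (begin
      i                                               ≡⟨ l₁ i w (+ D) ⟩
      i * (+ 1 + w * + D) - i * w * + D               ≡⟨ cong (λ z → i * z - i * w * + D) vB≡1+wD ⟨
      i * (v * + B) - i * w * + D                     ≡⟨ cong₂ (λ a b → a * (v * + B) - b * w * + D) i≡u′D i≡uB ⟩
      (+ 0 + u′ * + D) * (v * + B) - (+ 0 + u * + B) * w * + D ≡⟨ l₂ u u′ v w (+ B) (+ D) ⟩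
      + 0 + (u′ * v - u * w) * (+ B * + D)             ≡⟨ cong (λ z → + 0 + (u′ * v - u * w) * z) (ℤP.pos-* B D) ⟨
      + 0 + (u′ * v - u * w) * + (B ℕ.* D)             ∎)
    where
    open ≡-Reasoning
    l₁ : ∀ i w D → i ≡ i * (+ 1 + w * D) - i * w * D
    l₁ = solve-∀
    l₂ : ∀ u u′ v w B D → (+ 0 + u′ * D) * (v * B) - (+ 0 + u * B) * w * D ≡ + 0 + (u′ * v - u * w) * (B * D)
    l₂ = solve-∀

  split-mod : ∀ {B D} → Invertible D (+ B) → ∀ x →
              Σ ℤ λ x₁ → Σ ℤ λ x₂ → x₁ ≡ + 0 [mod B ] × x₂ ≡ + 0 [mod D ] × x ≡ x₁ + x₂
  split-mod {B} {D} (v , by-multiple w vB≡1+wD) x =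
    x * v * + B , - (x * w * + D) ,
    by-multiple (x * v) (l₁ x v (+ B)) , by-multiple (- (x * w)) (l₂ x w (+ D)) ,
    trans (l₃ x w (+ D)) (trans (cong (λ z → x * z - x * w * + D) (sym vB≡1+wD)) (l₄ x v (+ B) w (+ D)))
    where
    l₁ : ∀ x v B → x * v * B ≡ + 0 + (x * v) * B
    l₁ = solve-∀
    l₂ : ∀ x w D → - (x * w * D) ≡ + 0 + (- (x * w)) * D
    l₂ = solve-∀
    l₃ : ∀ x w D → x ≡ x * (+ 1 + w * D) - x * w * D
    l₃ = solve-∀
    l₄ : ∀ x v B w D → x * (v * B) - x * w * D ≡ x * v * B + - (x * w * D)
    l₄ = solve-∀

module Arithmetic where

  open import Data.Nat as ℕ using (ℕ; zero; suc; NonZero; _^_; _≤_; _<_)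
  import Data.Nat.Properties as ℕP
  open import Data.Nat.Divisibility as ℕD using (_∣_; divides; _∣?_)
  import Data.Nat.DivMod as ℕM
  open import Data.Nat.Coprimality as ℕC using (Coprime)
  open import Data.Nat.Primality
    using (Prime; prime; composite; composite?; prime?; prime⇒irreducible; prime⇒nonZero; prime⇒nonTrivial; euclidsLemma)
  open import Data.Nat.Induction using (<-rec)
  import Data.Nat.Tactic.RingSolver as ℕS
  open import Data.Integer using (+_; _+_; _*_; -_; _-_)
  import Data.Integer.Properties as ℤP
  open import Data.Integer.Tactic.RingSolver using (solve-∀)
  open import Data.Product using (∃; ∃₂; _×_; _,_)
  open import Data.Sum using (inj₁; inj₂)
  open import Data.Empty using (⊥; ⊥-elim)
  open import Relation.Nullary using (¬_; yes; no)
  open import Relation.Binary.PropositionalEquality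
    using (_≡_; _≢_; refl; sym; trans; cong; subst; module ≡-Reasoning)
  open Congruence

  geom : ℕ → ℕ → ℕ
  geom y zero    = 0
  geom y (suc N) = 1 ℕ.+ y ℕ.* geom y N

  geom-+ : ∀ y N c → geom y (N ℕ.+ c) ≡ geom y N ℕ.+ y ^ N ℕ.* geom y c
  geom-+ y zero c = sym (ℕP.+-identityʳ (geom y c))
  geom-+ y (suc N) c rewrite geom-+ y N c = l y (geom y N) (y ^ N) (geom y c)
    where
    l : ∀ y a b c → 1 ℕ.+ y ℕ.* (a ℕ.+ b ℕ.* c) ≡ 1 ℕ.+ y ℕ.* a ℕ.+ y ℕ.* b ℕ.* c
    l = ℕS.solve-∀

  geom-suc : ∀ y N → geom y (suc N) ≡ y ^ N ℕ.+ geom y N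
  geom-suc y N = begin
    geom y (suc N)                   ≡⟨ cong (geom y) (ℕP.+-comm 1 N) ⟩
    geom y (N ℕ.+ 1)                 ≡⟨ geom-+ y N 1 ⟩
    geom y N ℕ.+ y ^ N ℕ.* (1 ℕ.+ y ℕ.* 0) ≡⟨ cong (λ z → geom y N ℕ.+ y ^ N ℕ.* suc z) (ℕP.*-zeroʳ y) ⟩
    geom y N ℕ.+ y ^ N ℕ.* 1         ≡⟨ cong (geom y N ℕ.+_) (ℕP.*-identityʳ (y ^ N)) ⟩
    geom y N ℕ.+ y ^ N               ≡⟨ ℕP.+-comm (geom y N) (y ^ N) ⟩
    y ^ N ℕ.+ geom y N               ∎
    where open ≡-Reasoning

  geom-* : ∀ y a b → geom y (b ℕ.* a) ≡ geom y a ℕ.* geom (y ^ a) b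
  geom-* y a zero = sym (ℕP.*-zeroʳ (geom y a))
  geom-* y a (suc b) rewrite geom-+ y a (b ℕ.* a) | geom-* y a b = l (geom y a) (y ^ a) (geom (y ^ a) b)
    where
    l : ∀ s p t → s ℕ.+ p ℕ.* (s ℕ.* t) ≡ s ℕ.* (1 ℕ.+ p ℕ.* t)
    l = ℕS.solve-∀

  geom-1 : ∀ N → geom 1 N ≡ N
  geom-1 zero    = refl
  geom-1 (suc N) = cong suc (trans (ℕP.+-identityʳ (geom 1 N)) (geom-1 N))

  geom-telescope : ∀ y N → (+ y - + 1) * + geom y N ≡ + (y ^ N) - + 1
  geom-telescope y zero = l (+ y)
    where
    l : ∀ Y → (Y - + 1) * + 0 ≡ + 1 - + 1
    l = solve-∀
  geom-telescope y (suc N) = begin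
    (+ y - + 1) * + geom y (suc N)                         ≡⟨ cong ((+ y - + 1) *_) (trans (ℤP.pos-+ 1 _) (cong (_+_ (+ 1)) (ℤP.pos-* y _))) ⟩
    (+ y - + 1) * (+ 1 + + y * + geom y N)                 ≡⟨ l₁ (+ y) (+ geom y N) ⟩
    (+ y - + 1) + + y * ((+ y - + 1) * + geom y N)         ≡⟨ cong (λ z → (+ y - + 1) + + y * z) (geom-telescope y N) ⟩
    (+ y - + 1) + + y * (+ (y ^ N) - + 1)                  ≡⟨ l₂ (+ y) (+ (y ^ N)) ⟩
    + y * + (y ^ N) - + 1                                  ≡⟨ cong (_- + 1) (ℤP.pos-* y (y ^ N)) ⟨
    + (y ^ suc N) - + 1                                    ∎
    where
    open ≡-Reasoning
    l₁ : ∀ Y s → (Y - + 1) * (+ 1 + Y * s) ≡ (Y - + 1) + Y * ((Y - + 1) * s)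
    l₁ = solve-∀
    l₂ : ∀ Y P → (Y - + 1) + Y * (P - + 1) ≡ Y * P - + 1
    l₂ = solve-∀

  module _ {d : ℕ} where

    ^-mod : ∀ {x y} k → + x ≡ + y [mod d ] → + (x ^ k) ≡ + (y ^ k) [mod d ]
    ^-mod zero p = mod-refl
    ^-mod {x} {y} (suc k) p =
      mod-respˡ (sym (ℤP.pos-* x (x ^ k))) (mod-respʳ (sym (ℤP.pos-* y (y ^ k))) (mod-* p (^-mod k p)))

    ^-≡1 : ∀ {x} k → + x ≡ + 1 [mod d ] → + (x ^ k) ≡ + 1 [mod d ]
    ^-≡1 k p = mod-respʳ (cong +_ (ℕP.^-zeroˡ k)) (^-mod k p)

    ^-multiple-≡1 : ∀ {x e} q → + (x ^ e) ≡ + 1 [mod d ] → + (x ^ (q ℕ.* e)) ≡ + 1 [mod d ]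
    ^-multiple-≡1 {x} {e} q p =
      mod-respˡ (cong +_ (trans (ℕP.^-*-assoc x e q) (cong (x ^_) (ℕP.*-comm e q)))) (^-≡1 q p)

    geom-mod : ∀ {y y′} N → + y ≡ + y′ [mod d ] → + geom y N ≡ + geom y′ N [mod d ]
    geom-mod zero p = mod-refl
    geom-mod {y} {y′} (suc N) p =
      mod-respˡ (sym (pos y N)) (mod-respʳ (sym (pos y′ N)) (mod-+ (mod-refl {x = + 1}) (mod-* p (geom-mod N p))))
      where
      pos : ∀ y N → + geom y (suc N) ≡ + 1 + + y * + geom y N
      pos y N = trans (ℤP.pos-+ 1 (y ℕ.* geom y N)) (cong (_+_ (+ 1)) (ℤP.pos-* y (geom y N)))

    geom-≡1 : ∀ {y} N → + y ≡ + 1 [mod d ] → + geom y N ≡ + N [mod d ]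
    geom-≡1 N p = mod-respʳ (cong +_ (geom-1 N)) (geom-mod N p)

  p^k∣geom : ∀ {p y} k → + y ≡ + 1 [mod p ] → p ^ k ∣ geom y (p ^ k)
  p^k∣geom zero _ = ℕD.1∣ _
  p^k∣geom {p} {y} (suc k) y≡1 =
    subst (_∣ geom y (p ℕ.* p ^ k)) (ℕP.*-comm (p ^ k) p)
      (subst (p ^ k ℕ.* p ∣_) (sym (geom-* y (p ^ k) p)) (ℕD.*-pres-∣ (p^k∣geom k y≡1) p∣geom))
    where
    p∣geom : p ∣ geom (y ^ (p ^ k)) p
    p∣geom = ≡0⇒∣ (mod-trans (geom-≡1 p (^-≡1 (p ^ k) y≡1)) (∣⇒≡0 ℕD.∣-refl))

  module _ {M d y : ℕ} .{{_ : NonZero d}} where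

    ^-reduce : + (y ^ d) ≡ + 1 [mod M ] → ∀ k → + (y ^ k) ≡ + (y ^ (k ℕ.% d)) [mod M ]
    ^-reduce yᵈ≡1 k = begin
      + (y ^ k)                        ≡⟨ cong (λ z → + (y ^ z)) (ℕM.m≡m%n+[m/n]*n k d) ⟩
      + (y ^ (ρ ℕ.+ q ℕ.* d))          ≡⟨ cong +_ (ℕP.^-distribˡ-+-* y ρ (q ℕ.* d)) ⟩
      + (y ^ ρ ℕ.* y ^ (q ℕ.* d))      ≡⟨ ℤP.pos-* (y ^ ρ) (y ^ (q ℕ.* d)) ⟩
      + (y ^ ρ) * + (y ^ (q ℕ.* d))    ≈⟨ mod-*ˡ (+ (y ^ ρ)) (^-multiple-≡1 q yᵈ≡1) ⟩
      + (y ^ ρ) * + 1                  ≡⟨ ℤP.*-identityʳ (+ (y ^ ρ)) ⟩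
      + (y ^ ρ)                        ∎
      where
      open mod-Reasoning M
      ρ q : ℕ
      ρ = k ℕ.% d
      q = k ℕ./ d

    ^-period : + (y ^ d) ≡ + 1 [mod M ] → ∀ {k k′} → + k ≡ + k′ [mod d ] → + (y ^ k) ≡ + (y ^ k′) [mod M ]
    ^-period yᵈ≡1 {k} {k′} p =
      mod-trans (^-reduce yᵈ≡1 k) (mod-trans (mod-reflexive (cong (λ z → + (y ^ z)) (mod⇒%ℕ≡ d p))) (mod-sym (^-reduce yᵈ≡1 k′)))

    geom-reduce : + geom y d ≡ + 0 [mod M ] → ∀ k → + geom y k ≡ + geom y (k ℕ.% d) [mod M ]
    geom-reduce geomᵈ≡0 k = begin
      + geom y k                                         ≡⟨ cong (λ z → + geom y z) (ℕM.m≡m%n+[m/n]*n k d) ⟩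
      + geom y (ρ ℕ.+ q ℕ.* d)                           ≡⟨ cong +_ (geom-+ y ρ (q ℕ.* d)) ⟩
      + (geom y ρ ℕ.+ y ^ ρ ℕ.* geom y (q ℕ.* d))        ≡⟨ cong (λ z → + (geom y ρ ℕ.+ y ^ ρ ℕ.* z)) (geom-* y d q) ⟩
      + (geom y ρ ℕ.+ y ^ ρ ℕ.* (geom y d ℕ.* geom (y ^ d) q))
                                                        ≡⟨ ℤP.pos-+ (geom y ρ) _ ⟩
      + geom y ρ + + (y ^ ρ ℕ.* (geom y d ℕ.* geom (y ^ d) q))
                                                        ≡⟨ cong (_+_ (+ geom y ρ)) (trans (ℤP.pos-* (y ^ ρ) _) (cong (+ (y ^ ρ) *_) (ℤP.pos-* (geom y d) (geom (y ^ d) q)))) ⟩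
      + geom y ρ + + (y ^ ρ) * (+ geom y d * + geom (y ^ d) q)
                                                        ≈⟨ mod-+ (mod-refl {x = + geom y ρ}) (mod-*ˡ (+ (y ^ ρ)) (mod-*ʳ (+ geom (y ^ d) q) geomᵈ≡0)) ⟩
      + geom y ρ + + (y ^ ρ) * (+ 0 * + geom (y ^ d) q)  ≡⟨ l (+ geom y ρ) (+ (y ^ ρ)) (+ geom (y ^ d) q) ⟩
      + geom y ρ                                         ∎
      where
      open mod-Reasoning M
      ρ q : ℕ
      ρ = k ℕ.% d
      q = k ℕ./ d
      l : ∀ a b c → a + b * (+ 0 * c) ≡ a
      l = solve-∀

    geom-period : + geom y d ≡ + 0 [mod M ] → ∀ {k k′} → + k ≡ + k′ [mod d ] → + geom y k ≡ + geom y k′ [mod M ]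
    geom-period geom≡0 {k} {k′} p =
      mod-trans (geom-reduce geom≡0 k) (mod-trans (mod-reflexive (cong (λ z → + geom y z) (mod⇒%ℕ≡ d p))) (mod-sym (geom-reduce geom≡0 k′)))

  order-∣ : ∀ {M y n₀} .{{_ : NonZero n₀}} → + (y ^ n₀) ≡ + 1 [mod M ] →
            (∀ k → 1 ≤ k → + (y ^ k) ≡ + 1 [mod M ] → n₀ ≤ k) →
            ∀ k → + (y ^ k) ≡ + 1 [mod M ] → n₀ ∣ k
  order-∣ {M} {y} {n₀} yⁿ⁰≡1 minimal k yᵏ≡1 = go (k ℕ.% n₀) refl (mod-trans (mod-sym (^-reduce yⁿ⁰≡1 k)) yᵏ≡1)
    where
    go : ∀ ρ → ρ ≡ k ℕ.% n₀ → + (y ^ ρ) ≡ + 1 [mod M ] → n₀ ∣ k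
    go zero    ρ≡ _   = ℕD.m%n≡0⇒n∣m k n₀ (sym ρ≡)
    go (suc ρ) ρ≡ y^ρ≡1 =
      ⊥-elim (ℕP.<⇒≱ (subst (_< n₀) (sym ρ≡) (ℕM.m%n<n k n₀)) (minimal (suc ρ) (ℕ.s≤s ℕ.z≤n) y^ρ≡1))

  <∧%≡0%⇒≡0 : ∀ {a d} .{{_ : NonZero d}} → a < d → a ℕ.% d ≡ 0 ℕ.% d → a ≡ 0
  <∧%≡0%⇒≡0 {a} {suc _} a<d eq = trans (sym (ℕM.m<n⇒m%n≡m a<d)) eq

  prime⇒>1 : ∀ {p} → Prime p → 1 < p
  prime⇒>1 {p} pp = ℕ.nonTrivial⇒n>1 p {{prime⇒nonTrivial pp}}

  prime≢1 : ∀ {p} → Prime p → p ≢ 1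
  prime≢1 pp refl = ℕP.<-irrefl refl (prime⇒>1 pp)

  ∃-prime-divisor : ∀ i → 2 ≤ i → ∃ λ p → Prime p × p ∣ i
  ∃-prime-divisor = <-rec _ go
    where
    go : ∀ i → (∀ {j} → j < i → 2 ≤ j → ∃ λ p → Prime p × p ∣ j) → 2 ≤ i → ∃ λ p → Prime p × p ∣ i
    go i@(suc (suc _)) rec _ with prime? i | composite? i
    ... | yes pr | _ = i , pr , ℕD.∣-refl
    ... | no _   | yes (composite {d} d<i d∣i) with rec d<i (ℕ.nonTrivial⇒n>1 d)
    ...   | p , pp , p∣d = p , pp , ℕD.∣-trans p∣d d∣i
    go i@(suc (suc _)) rec _ | no ¬pr | no ¬c = ⊥-elim (¬pr (prime ¬c))
    go (suc zero) rec (ℕ.s≤s ())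

  no-common-prime⇒coprime : ∀ {a d} .{{_ : NonZero d}} → (∀ p → Prime p → p ∣ a → p ∣ d → ⊥) → Coprime a d
  no-common-prime⇒coprime {d = d} _ {zero} (_ , 0∣d) = ⊥-elim (ℕ.≢-nonZero⁻¹ d (ℕD.0∣⇒≡0 0∣d))
  no-common-prime⇒coprime _ {suc zero} _ = refl
  no-common-prime⇒coprime h {suc (suc i)} (i∣a , i∣d) with ∃-prime-divisor (suc (suc i)) (ℕ.s≤s (ℕ.s≤s ℕ.z≤n))
  ... | p , pp , p∣i = ⊥-elim (h p pp (ℕD.∣-trans p∣i i∣a) (ℕD.∣-trans p∣i i∣d))

  no-common-prime⇒invertible : ∀ {a d} .{{_ : NonZero d}} → (∀ p → Prime p → p ∣ a → p ∣ d → ⊥) → Invertible d (+ a)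
  no-common-prime⇒invertible h = coprime⇒invertible (no-common-prime⇒coprime h)

  coprime⇒≢0 : ∀ {x d} → 1 < d → Coprime x d → 1 ≤ x
  coprime⇒≢0 {zero}  1<d 0-coprime-d = ⊥-elim (ℕP.<-irrefl (sym (ℕC.0-coprimeTo-m⇒m≡1 0-coprime-d)) 1<d)
  coprime⇒≢0 {suc _} _   _           = ℕ.s≤s ℕ.z≤n

  prime∤⇒coprime : ∀ {p a} → Prime p → ¬ p ∣ a → Coprime p a
  prime∤⇒coprime pp p∤a {i} (i∣p , i∣a) with prime⇒irreducible pp i∣p
  ... | inj₁ i≡1 = i≡1
  ... | inj₂ refl = ⊥-elim (p∤a i∣a)

  prime∣prime⇒≡ : ∀ {p q} → Prime p → Prime q → p ∣ q → p ≡ q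
  prime∣prime⇒≡ pp pq p∣q with prime⇒irreducible pq p∣q
  ... | inj₁ refl = ⊥-elim (prime≢1 pp refl)
  ... | inj₂ p≡q = p≡q

  prime∣prime^⇒≡ : ∀ {p q} k → Prime p → Prime q → p ∣ q ^ k → p ≡ q
  prime∣prime^⇒≡ zero pp pq p∣1 = ⊥-elim (prime≢1 pp (ℕD.∣1⇒≡1 p∣1))
  prime∣prime^⇒≡ {q = q} (suc k) pp pq p∣qq^k with euclidsLemma q (q ^ k) pp p∣qq^k
  ... | inj₁ p∣q   = prime∣prime⇒≡ pp pq p∣q
  ... | inj₂ p∣q^k = prime∣prime^⇒≡ k pp pq p∣q^k

  prime∤⇒invertible-mod-^ : ∀ {p a} e → Prime p → ¬ p ∣ a → Invertible (p ^ e) (+ a)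
  prime∤⇒invertible-mod-^ {p} e pp p∤a = no-common-prime⇒invertible {{ℕP.m^n≢0 p e {{prime⇒nonZero pp}}}}
    (λ q pq q∣a q∣pᵉ → p∤a (subst (_∣ _) (prime∣prime^⇒≡ e pq pp q∣pᵉ) q∣a))

  prime∤⇒prime-invertible : ∀ {p a} → Prime p → ¬ p ∣ a → Invertible a (+ p)
  prime∤⇒prime-invertible pp p∤a = coprime⇒invertible (prime∤⇒coprime pp p∤a)

  p-part : ∀ {p} → Prime p → ∀ d .{{_ : NonZero d}} → ∃₂ λ μ d′ → d ≡ p ^ μ ℕ.* d′ × ¬ p ∣ d′
  p-part {p} pp d = <-rec P go d
    where
    P : ℕ → Set
    P d = .{{_ : NonZero d}} → ∃₂ λ μ d′ → d ≡ p ^ μ ℕ.* d′ × ¬ p ∣ d′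
    go : ∀ d → (∀ {j} → j < d → P j) → P d
    go d rec with p ∣? d
    ... | no p∤d = 0 , d , sym (ℕP.+-identityʳ d) , p∤d
    ... | yes (divides zero refl) = ⊥-elim (ℕ.≢-nonZero⁻¹ 0 refl)
    ... | yes (divides q@(suc _) refl) with rec (ℕP.m<m*n q p (prime⇒>1 pp))
    ...   | μ , d′ , q≡ , p∤d′ = suc μ , d′ , trans (cong (ℕ._* p) q≡) (l (p ^ μ) d′ p) , p∤d′
      where
      l : ∀ a b c → a ℕ.* b ℕ.* c ≡ c ℕ.* a ℕ.* b
      l = ℕS.solve-∀

  p-part-exponent-≥1 : ∀ {p d μ d′} → p ∣ d → d ≡ p ^ μ ℕ.* d′ → ¬ p ∣ d′ → 1 ≤ μ
  p-part-exponent-≥1 {μ = zero} {d′} p∣d refl p∤d′ = ⊥-elim (p∤d′ (subst (_ ∣_) (ℕP.+-identityʳ d′) p∣d))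
  p-part-exponent-≥1 {μ = suc _} _ _ _ = ℕ.s≤s ℕ.z≤n

  p-part-< : ∀ {p μ d′} → Prime p → 1 ≤ μ → .{{_ : NonZero d′}} → d′ < p ^ μ ℕ.* d′
  p-part-< {p} {μ} {d′} pp μ≥1 = subst (d′ <_) (ℕP.*-comm d′ (p ^ μ)) (ℕP.m<m*n d′ (p ^ μ) 1<pᵘ)
    where
    1<pᵘ : 1 < p ^ μ
    1<pᵘ = ℕP.<-≤-trans (prime⇒>1 pp) (subst (_≤ p ^ μ) (ℕP.*-identityʳ p) (ℕP.^-monoʳ-≤ p {{prime⇒nonZero pp}} μ≥1))

open Congruence using (_≡_[mod_])

module Metacyclic (m n r : ℕ) .{{_ : NonZero m}} .{{_ : NonZero n}} (rⁿ≡1 : + (r ^ n) ≡ + 1 [mod m ]) where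

  open import Defs
  open Meta m n r
  open import Data.Nat as ℕ using (zero; suc)
  import Data.Nat.Properties as ℕP
  open import Data.Nat.Divisibility as ℕD using (_∣_; divides; _∣?_)
  open import Data.Nat.Primality using (Prime; prime[2])
  open import Data.Nat.Coprimality as ℕC using (Coprime)
  open import Data.Nat.GCD using (gcd)
  import Data.Nat.DivMod as ℕM
  import Data.Nat.Tactic.RingSolver as ℕS
  open import Data.Integer using (-[1+_]; _%ℕ_; ∣_∣; _+_; _*_; -_; _-_)
  import Data.Integer.Properties as ℤP
  import Data.Integer.DivMod as ℤD
  open import Data.Integer.Tactic.RingSolver using (solve-∀)
  open import Data.Product using (∃; _×_; _,_; proj₁; proj₂)
  open import Data.Sum using (_⊎_; inj₁; inj₂; [_,_]′)
  open import Data.Empty using (⊥-elim)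
  open import Function using (it)
  open import Level using (0ℓ)
  open import Relation.Nullary using (¬_)
  open import Relation.Nullary.Decidable using (toSum; decidable-stable)
  open import Relation.Binary.Bundles using (Setoid)
  open import Relation.Binary.PropositionalEquality
    using (_≡_; _≢_; refl; sym; trans; cong; cong₂; subst; subst₂; module ≡-Reasoning)
  import Relation.Binary.Reasoning.Setoid as SetoidReasoning
  open Congruence
  open Arithmetic

  r^_ : ℕ → ℤ
  r^ k = + (r ^ k)

  infix 4 _≅_
  _≅_ : Carrier → Carrier → Set
  (j , i) ≅ (j′ , i′) = (+ j ≡ + j′ [mod n ]) × (i ≡ i′ [mod m ])

  ≅⇒≈ : ∀ {x y} → x ≅ y → x ≈ y
  ≅⇒≈ (p , q) = mod⇒%ℕ≡ n p , mod⇒%ℕ≡ m q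

  ≈⇒≅ : ∀ {x y} → x ≈ y → x ≅ y
  ≈⇒≅ (p , q) = %ℕ≡⇒mod n p , %ℕ≡⇒mod m q

  ≅-refl : ∀ {x} → x ≅ x
  ≅-refl = mod-refl , mod-refl

  ≅-reflexive : ∀ {x y} → x ≡ y → x ≅ y
  ≅-reflexive refl = ≅-refl

  ≅-sym : ∀ {x y} → x ≅ y → y ≅ x
  ≅-sym (p , q) = mod-sym p , mod-sym q

  ≅-trans : ∀ {x y z} → x ≅ y → y ≅ z → x ≅ z
  ≅-trans (p , q) (p′ , q′) = mod-trans p p′ , mod-trans q q′

  ≅-setoid : Setoid 0ℓ 0ℓ
  ≅-setoid = record
    { Carrier = Carrier
    ; _≈_ = _≅_
    ; isEquivalence = record { refl = ≅-refl ; sym = ≅-sym ; trans = ≅-trans }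
    }

  module ≅-Reasoning = SetoidReasoning ≅-setoid

  1+[n∸1]≡n : suc (n ℕ.∸ 1) ≡ n
  1+[n∸1]≡n = l n
    where
    l : ∀ k .{{_ : NonZero k}} → suc (k ℕ.∸ 1) ≡ k
    l (suc k) = refl

  [n∸1]*k+k≡k*n : ∀ k → (n ℕ.∸ 1) ℕ.* k ℕ.+ k ≡ k ℕ.* n
  [n∸1]*k+k≡k*n k = trans (ℕP.+-comm _ k) (trans (ℕP.*-comm (suc (n ℕ.∸ 1)) k) (cong (k ℕ.*_) 1+[n∸1]≡n))

  r^-+ : ∀ a b → r^ (a ℕ.+ b) ≡ r^ a * r^ b
  r^-+ a b = trans (cong +_ (ℕP.^-distribˡ-+-* r a b)) (ℤP.pos-* (r ^ a) (r ^ b))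

  r^-cong : ∀ {k k′} → + k ≡ + k′ [mod n ] → r^ k ≡ r^ k′ [mod m ]
  r^-cong = ^-period rⁿ≡1

  r^-inverse : ∀ k → r^ ((n ℕ.∸ 1) ℕ.* k) * r^ k ≡ + 1 [mod m ]
  r^-inverse k = mod-respˡ (trans (cong r^_ (sym ([n∸1]*k+k≡k*n k))) (r^-+ ((n ℕ.∸ 1) ℕ.* k) k)) (^-multiple-≡1 k rⁿ≡1)

  r^-invertible : ∀ k → Invertible m (r^ k)
  r^-invertible k = r^ ((n ℕ.∸ 1) ℕ.* k) , r^-inverse k

  r-invertible : Invertible m (+ r)
  r-invertible = subst (Invertible m) (cong +_ (ℕP.*-identityʳ r)) (r^-invertible 1)

  ∙-cong : ∀ {x x′ y y′} → x ≅ x′ → y ≅ y′ → x ∙ y ≅ x′ ∙ y′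
  ∙-cong {j , _} {j′ , _} {k , _} {k′ , _} (p , q) (p′ , q′) =
    mod-respˡ (sym (ℤP.pos-+ j k)) (mod-respʳ (sym (ℤP.pos-+ j′ k′)) (mod-+ p p′)) ,
    mod-+ (mod-* q (r^-cong p′)) q′

  pow-≡ : ∀ k u N → pow (k , u) N ≡ (N ℕ.* k , u * + geom (r ^ k) N)
  pow-≡ k u zero = cong (0 ,_) (sym (ℤP.*-zeroʳ u))
  pow-≡ k u (suc N) rewrite pow-≡ k u N = cong (k ℕ.+ N ℕ.* k ,_) (sym (begin
    u * + geom (r ^ k) (suc N)                   ≡⟨ cong (λ z → u * + z) (geom-suc (r ^ k) N) ⟩
    u * + ((r ^ k) ^ N ℕ.+ geom (r ^ k) N)       ≡⟨ cong (u *_) (ℤP.pos-+ ((r ^ k) ^ N) _) ⟩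
    u * (+ ((r ^ k) ^ N) + + geom (r ^ k) N)     ≡⟨ cong (λ z → u * (+ z + + geom (r ^ k) N)) (ℕP.^-*-assoc r k N) ⟩
    u * (r^ (k ℕ.* N) + + geom (r ^ k) N)        ≡⟨ cong (λ z → u * (r^ z + + geom (r ^ k) N)) (ℕP.*-comm k N) ⟩
    u * (r^ (N ℕ.* k) + + geom (r ^ k) N)        ≡⟨ ℤP.*-distribˡ-+ u _ _ ⟩
    u * r^ (N ℕ.* k) + u * + geom (r ^ k) N      ∎))
    where open ≡-Reasoning

  pow-cong : ∀ {x y} N → x ≅ y → pow x N ≅ pow y N
  pow-cong zero    p = ≅-refl
  pow-cong (suc N) p = ∙-cong p (pow-cong N p)

  idempotent⇒≅e : ∀ x → x ≅ x ∙ x → x ≅ e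
  idempotent⇒≅e (j , i) (p , q) = j≡0 , invertible-cancel-≡0 (r^-invertible j) ir^j≡0
    where
    j≡0 : + j ≡ + 0 [mod n ]
    j≡0 = mod-sym (mod-+-cancelʳ (+ j)
      (mod-respˡ (sym (ℤP.+-identityˡ (+ j))) (mod-respʳ (ℤP.pos-+ j j) p)))
    ir^j≡0 : i * r^ j ≡ + 0 [mod m ]
    ir^j≡0 = mod-sym (mod-+-cancelʳ i (mod-respˡ (sym (ℤP.+-identityˡ i)) q))

  module HomProperties {σ : Carrier → Carrier} (isHom : IsHom σ) where

    σ-cong : ∀ {x y} → x ≅ y → σ x ≅ σ y
    σ-cong p = ≈⇒≅ (IsHom.cong isHom (≅⇒≈ p))

    σ-hom : ∀ x y → σ (x ∙ y) ≅ σ x ∙ σ y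
    σ-hom x y = ≈⇒≅ (IsHom.hom isHom x y)

    σ-e : σ e ≅ e
    σ-e = idempotent⇒≅e (σ e) (σ-hom e e)

    σ-pow : ∀ x N → σ (pow x N) ≅ pow (σ x) N
    σ-pow x zero    = σ-e
    σ-pow x (suc N) = ≅-trans (σ-hom x (pow x N)) (∙-cong (≅-refl {σ x}) (σ-pow x N))

  isAut-resp : ∀ {σ τ} → IsHom σ → (∀ x → σ x ≅ τ x) → IsAut τ → IsAut σ
  isAut-resp {σ} {τ} σ-hom σ≅τ τ-aut = record
    { isHom      = σ-hom
    ; injective  = σ-injective
    ; surjective = σ-surjective
    }
    where
    open IsAut τ-aut
    σ-injective : ∀ {x y} → σ x ≈ σ y → x ≈ y
    σ-injective {x} {y} σx≈σy = injective (≅⇒≈ (≅-trans (≅-sym (σ≅τ x)) (≅-trans (≈⇒≅ {σ x} {σ y} σx≈σy) (σ≅τ y))))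
    σ-surjective : ∀ y → ∃ λ x → σ x ≈ y
    σ-surjective y = let x , τx≈y = surjective y in x , ≅⇒≈ (≅-trans (σ≅τ x) (≈⇒≅ {τ x} {y} τx≈y))

  pow-a : ∀ k → pow a k ≡ (0 , + k)
  pow-a k = trans (pow-≡ 0 (+ 1) k) (cong₂ _,_ (ℕP.*-zeroʳ k) (trans (ℤP.*-identityˡ _) (cong +_ (geom-1 k))))

  pow-b : ∀ k → pow b k ≡ (k , + 0)
  pow-b k = trans (pow-≡ 1 (+ 0) k) (cong (_, + 0) (ℕP.*-identityʳ k))

  normal-form : ∀ j i → (j , i) ≅ pow b j ∙ pow a (i %ℕ m)
  normal-form j i rewrite pow-b j | pow-a (i %ℕ m) =
    mod-reflexive (cong +_ (sym (ℕP.+-identityʳ j))) , mod-%ℕ m i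

  powℤ-a : ∀ t → powℤ a t ≅ (0 , t)
  powℤ-a (+ k)    = ≅-reflexive (pow-a k)
  powℤ-a -[1+ k ] = ≅-reflexive (l ((n ℕ.∸ 1) ℕ.* 0) (ℕP.*-zeroʳ (n ℕ.∸ 1)))
    where
    l : ∀ K → K ≡ 0 → pow (K , - (+ 1 * r^ K)) (suc k) ≡ (0 , -[1+ k ])
    l K refl = trans (pow-≡ 0 (-[1+ 0 ]) (suc k))
      (cong₂ _,_ (ℕP.*-zeroʳ k) (trans (ℤP.-1*i≡-i _) (cong -_ (cong +_ (geom-1 (suc k))))))

  powℤ-b : ∀ j → powℤ b j ≅ (j %ℕ n , + 0)
  powℤ-b (+ k)    = ≅-trans (≅-reflexive (pow-b k)) (mod-%ℕ n (+ k) , mod-refl)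
  powℤ-b -[1+ k ] = ≅-trans (≅-reflexive (pow-≡ K (- (+ 0 * r^ K)) (suc k)))
    (mod-trans [1+k]K≡-[1+k] (mod-%ℕ n -[1+ k ]) , mod-refl)
    where
    K : ℕ
    K = (n ℕ.∸ 1) ℕ.* 1
    [1+k]K≡-[1+k] : + (suc k ℕ.* K) ≡ -[1+ k ] [mod n ]
    [1+k]K≡-[1+k] = by-multiple (+ suc k) (l (+ (suc k ℕ.* K)) (+ suc k) (+ suc k * + n)
      (trans (sym (ℤP.pos-+ (suc k ℕ.* K) (suc k)))
        (trans (cong +_ (trans (cong (λ z → z ℕ.+ suc k) (ℕP.*-comm (suc k) K))
          (trans (cong (λ z → z ℕ.* suc k ℕ.+ suc k) (ℕP.*-identityʳ (n ℕ.∸ 1))) ([n∸1]*k+k≡k*n (suc k)))))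
          (ℤP.pos-* (suc k) n))))
      where
      l : ∀ X K N → X + K ≡ N → X ≡ - K + N
      l X K N eq = trans (l′ X K) (cong (_+_ (- K)) eq)
        where
        l′ : ∀ X K → X ≡ - K + (X + K)
        l′ = solve-∀

  module Block (α β : ℕ) (α∣n : α ∣ n) (β∣m : β ∣ m) where

    InBlock : Carrier → Set
    InBlock (j , i) = (+ j ≡ + 0 [mod α ]) × (i ≡ + 0 [mod β ])

    InBlock-resp : ∀ {x y} → x ≅ y → InBlock x → InBlock y
    InBlock-resp (p , q) (j≡0 , i≡0) = mod-trans (mod-sym (mod-∣ α∣n p)) j≡0 , mod-trans (mod-sym (mod-∣ β∣m q)) i≡0

    InBlock-∙ : ∀ {x y} → InBlock x → InBlock y → InBlock (x ∙ y)
    InBlock-∙ {j , _} {k , _} (j≡0 , i≡0) (k≡0 , l≡0) =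
      mod-respˡ (sym (ℤP.pos-+ j k)) (mod-+ j≡0 k≡0) , mod-+ (mod-*ʳ (r^ k) i≡0) l≡0

    InBlock-⁻¹ : ∀ {x} → InBlock x → InBlock (x ⁻¹)
    InBlock-⁻¹ {j , _} (j≡0 , i≡0) =
      mod-respˡ (sym (ℤP.pos-* (n ℕ.∸ 1) j)) (mod-respʳ (ℤP.*-zeroʳ (+ (n ℕ.∸ 1))) (mod-*ˡ (+ (n ℕ.∸ 1)) j≡0)) ,
      mod-neg (mod-*ʳ _ i≡0)

    subgroup : Subgroup
    subgroup = record
      { P         = InBlock
      ; resp      = λ x≈y → InBlock-resp (≈⇒≅ x≈y)
      ; has-e     = mod-refl , mod-refl
      ; closed-∙  = InBlock-∙
      ; closed-⁻¹ = InBlock-⁻¹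
      }

    normal : (∀ j → + j ≡ + 0 [mod α ] → r^ j ≡ + 1 [mod β ]) → IsNormal subgroup
    normal r^j≡1 (k , l) (j , i) (j≡0 , i≡0) = conj-j≡0 , conj-i≡0
      where
      conj-j≡j : + (k ℕ.+ j ℕ.+ (n ℕ.∸ 1) ℕ.* k) ≡ + j [mod n ]
      conj-j≡j = by-multiple (+ k) (trans (cong +_ (trans (l₁ k j (n ℕ.∸ 1)) (cong (λ z → j ℕ.+ k ℕ.* z) 1+[n∸1]≡n)))
                   (trans (ℤP.pos-+ j (k ℕ.* n)) (cong (_+_ (+ j)) (ℤP.pos-* k n))))
        where
        l₁ : ∀ k j N → k ℕ.+ j ℕ.+ N ℕ.* k ≡ j ℕ.+ k ℕ.* suc N
        l₁ = ℕS.solve-∀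
      conj-j≡0 : + (k ℕ.+ j ℕ.+ (n ℕ.∸ 1) ℕ.* k) ≡ + 0 [mod α ]
      conj-j≡0 = mod-trans (mod-∣ α∣n conj-j≡j) j≡0
      T : ℤ
      T = r^ ((n ℕ.∸ 1) ℕ.* k)
      conj-i≡0 : (l * r^ j + i) * T + - (l * T) ≡ + 0 [mod β ]
      conj-i≡0 = mod-respʳ (l₂ l T) (mod-+ (mod-*ʳ T (mod-+ (mod-*ˡ l (r^j≡1 j j≡0)) i≡0)) mod-refl)
        where
        l₂ : ∀ l T → (l * + 1 + + 0) * T + - (l * T) ≡ + 0
        l₂ = solve-∀

    nonTrivial : α ℕ.< n ⊎ β ℕ.< m → NonTrivial subgroup
    nonTrivial (inj₁ α<n) = (α , + 0) , (∣⇒≡0 ℕD.∣-refl , mod-refl) , λ (α≡0 , _) → α≢0 (<∧%≡0%⇒≡0 α<n α≡0)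
      where
      α≢0 : α ≢ 0
      α≢0 refl = ℕ.≢-nonZero⁻¹ n (ℕD.0∣⇒≡0 α∣n)
    nonTrivial (inj₂ β<m) = (0 , + β) , (mod-refl , ∣⇒≡0 ℕD.∣-refl) , λ (_ , β≡0) → β≢0 (<∧%≡0%⇒≡0 β<m β≡0)
      where
      β≢0 : β ≢ 0
      β≢0 refl = ℕ.≢-nonZero⁻¹ m (ℕD.0∣⇒≡0 β∣m)

  module _ {α β γ δ : ℕ} (α∣n : α ∣ n) (β∣m : β ∣ m) (γ∣n : γ ∣ n) (δ∣m : δ ∣ m) where

    private
      module H = Block α β α∣n β∣m
      module K = Block γ δ γ∣n δ∣m

    isDirectProduct : (∀ j → + j ≡ + 0 [mod α ] → r^ j ≡ + 1 [mod β ]) →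
                      (∀ j → + j ≡ + 0 [mod γ ] → r^ j ≡ + 1 [mod δ ]) →
                      Invertible γ (+ α) → Invertible δ (+ β) → α ℕ.* γ ≡ n → β ℕ.* δ ≡ m →
                      IsDirectProductOf H.subgroup K.subgroup
    isDirectProduct H-normal K-normal α-inv β-inv αγ≡n βδ≡m = H.normal H-normal , K.normal K-normal , meet , join
      where
      meet : ∀ x → H.InBlock x → K.InBlock x → x ≈ e
      meet (j , i) (j≡0[α] , i≡0[β]) (j≡0[γ] , i≡0[δ]) = ≅⇒≈ {j , i} {e}
        ( subst (λ d → + j ≡ + 0 [mod d ]) αγ≡n (≡0-mod-* α-inv j≡0[α] j≡0[γ])
        , subst (λ d → i ≡ + 0 [mod d ]) βδ≡m (≡0-mod-* β-inv i≡0[β] i≡0[δ]) )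

      reduce : ∀ {d x} → d ∣ n → x ≡ + 0 [mod d ] → + (x %ℕ n) ≡ + 0 [mod d ]
      reduce d∣n x≡0 = mod-trans (mod-∣ d∣n (mod-sym (mod-%ℕ n _))) x≡0

      T : ℤ → ℤ
      T j₂ = r^ ((n ℕ.∸ 1) ℕ.* (j₂ %ℕ n))

      factor : ∀ {j i j₁ j₂ i₁ i₂} → + j ≡ j₁ + j₂ → i ≡ i₁ + i₂ → (j , i) ≅ (j₁ %ℕ n , i₁ * T j₂) ∙ (j₂ %ℕ n , i₂)
      factor {j} {i} {j₁} {j₂} {i₁} {i₂} j≡j₁+j₂ i≡i₁+i₂ =
        mod-respˡ (sym j≡j₁+j₂) (mod-respʳ (sym (ℤP.pos-+ (j₁ %ℕ n) (j₂ %ℕ n))) (mod-+ (mod-%ℕ n j₁) (mod-%ℕ n j₂))) ,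
        (begin
          i                               ≡⟨ i≡i₁+i₂ ⟩
          i₁ + i₂                         ≡⟨ cong (_+ i₂) (ℤP.*-identityʳ i₁) ⟨
          i₁ * + 1 + i₂                   ≈⟨ mod-+ (mod-*ˡ i₁ (r^-inverse (j₂ %ℕ n))) (mod-refl {x = i₂}) ⟨
          i₁ * (T j₂ * r^ (j₂ %ℕ n)) + i₂ ≡⟨ cong (_+ i₂) (ℤP.*-assoc i₁ (T j₂) (r^ (j₂ %ℕ n))) ⟨
          i₁ * T j₂ * r^ (j₂ %ℕ n) + i₂   ∎)
        where open mod-Reasoning m

      join : ∀ g → ∃ λ h → ∃ λ k → H.InBlock h × K.InBlock k × g ≈ h ∙ k
      join (j , i) =
        let j₁ , j₂ , j₁≡0 , j₂≡0 , j≡j₁+j₂ = split-mod α-inv (+ j)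
            i₁ , i₂ , i₁≡0 , i₂≡0 , i≡i₁+i₂ = split-mod β-inv i
        in (j₁ %ℕ n , i₁ * T j₂) , (j₂ %ℕ n , i₂) ,
           (reduce α∣n j₁≡0 , mod-*ʳ (T j₂) i₁≡0) , (reduce γ∣n j₂≡0 , i₂≡0) ,
           ≅⇒≈ (factor {j₁ = j₁} {j₂} {i₁ = i₁} {i₂} j≡j₁+j₂ i≡i₁+i₂)

  pow≈e⇒ : ∀ j i N → pow (j , i) N ≈ e → (N ℕ.* j , i * + geom (r ^ j) N) ≅ e
  pow≈e⇒ j i N pow≈e = ≅-trans (≅-sym (≅-reflexive (pow-≡ j i N))) (≈⇒≅ pow≈e)

  module SylowBlock {p : ℕ} (pp : Prime p) {μ m′ ν n′ : ℕ}
                    (m≡pᵘm′ : m ≡ p ^ μ ℕ.* m′) (p∤m′ : ¬ p ∣ m′)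
                    (n≡pᵛn′ : n ≡ p ^ ν ℕ.* n′) (p∤n′ : ¬ p ∣ n′) where

    n′∣n : n′ ∣ n
    n′∣n = divides (p ^ ν) n≡pᵛn′

    m′∣m : m′ ∣ m
    m′∣m = divides (p ^ μ) m≡pᵘm′

    open Block n′ m′ n′∣n m′∣m public

    pᵏ-invertible : ∀ {d} k → ¬ p ∣ d → Invertible d (+ (p ^ k))
    pᵏ-invertible k p∤d = invertible-^ k (prime∤⇒prime-invertible pp p∤d)

    r^-≡1-mod-p : + (r ^ n′) ≡ + 1 [mod p ] → ∀ j → + j ≡ + 0 [mod n′ ] → r^ j ≡ + 1 [mod p ]
    r^-≡1-mod-p rⁿ′≡1 j j≡0 =
      mod-respˡ (cong r^_ (sym (ℕD.m∣n⇒n≡quotient*m (≡0⇒∣ j≡0)))) (^-multiple-≡1 (ℕD.quotient (≡0⇒∣ j≡0)) rⁿ′≡1)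

    isPSubgroup : + (r ^ n′) ≡ + 1 [mod p ] → IsPSubgroup p subgroup
    isPSubgroup rⁿ′≡1 (j , i) (j≡0 , i≡0) = μ ℕ.+ ν , ≅⇒≈ {pow (j , i) N} {e}
      (≅-trans (≅-reflexive (pow-≡ j i N)) (Nj≡0 , i·geom≡0))
      where
      N : ℕ
      N = p ^ (μ ℕ.+ ν)
      N≡pᵘpᵛ : N ≡ p ^ μ ℕ.* p ^ ν
      N≡pᵘpᵛ = ℕP.^-distribˡ-+-* p μ ν
      Nj≡0 : + (N ℕ.* j) ≡ + 0 [mod n ]
      Nj≡0 = ∣⇒≡0 (subst (_∣ N ℕ.* j) (sym n≡pᵛn′) (ℕD.*-pres-∣ (divides (p ^ μ) N≡pᵘpᵛ) (≡0⇒∣ j≡0)))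
      geom≡0 : + geom (r ^ j) N ≡ + 0 [mod p ^ μ ]
      geom≡0 = ∣⇒≡0 (ℕD.∣-trans (divides (p ^ ν) (trans N≡pᵘpᵛ (ℕP.*-comm (p ^ μ) (p ^ ν))))
                                 (p^k∣geom (μ ℕ.+ ν) (r^-≡1-mod-p rⁿ′≡1 j j≡0)))
      i·geom≡0 : i * + geom (r ^ j) N ≡ + 0 [mod m ]
      i·geom≡0 = subst (λ d → i * + geom (r ^ j) N ≡ + 0 [mod d ]) (trans (ℕP.*-comm m′ (p ^ μ)) (sym m≡pᵘm′)) (≡0-*-≡0 i≡0 geom≡0)

    isMaximal : ∀ K → IsPSubgroup p K → subgroup ⊆ K → K ⊆ subgroup
    isMaximal K K-p H⊆K (j , i) x∈K = j≡0 , i≡0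
      where
      k : ℕ
      k = proj₁ (K-p (j , i) x∈K)
      j≡0 : + j ≡ + 0 [mod n′ ]
      j≡0 = invertible-cancel-≡0 (pᵏ-invertible k p∤n′)
        (mod-respˡ (trans (ℤP.pos-* (p ^ k) j) (ℤP.*-comm (+ (p ^ k)) (+ j)))
          (mod-∣ n′∣n (proj₁ (pow≈e⇒ j i (p ^ k) (proj₂ (K-p (j , i) x∈K))))))
      y∈K : P K (j , + 0)
      y∈K = H⊆K (j , + 0) (j≡0 , mod-refl)
      -- z = x (b^j)⁻¹ lies in ⟨a⟩ and has p-power order, so its a-exponent lies in m′ℤ.
      z∈K : P K ((j , i) ∙ (j , + 0) ⁻¹)
      z∈K = closed-∙ K x∈K (closed-⁻¹ K y∈K)
      Jz : ℕ
      Jz = j ℕ.+ (n ℕ.∸ 1) ℕ.* j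
      Iz : ℤ
      Iz = i * r^ ((n ℕ.∸ 1) ℕ.* j) + + 0
      k′ : ℕ
      k′ = proj₁ (K-p _ z∈K)
      N : ℕ
      N = p ^ k′
      Jz≡0 : + Jz ≡ + 0 [mod n ]
      Jz≡0 = ∣⇒≡0 (divides j (trans (ℕP.+-comm j _) ([n∸1]*k+k≡k*n j)))
      IzN≡0 : Iz * + N ≡ + 0 [mod m ]
      IzN≡0 = mod-trans (mod-*ˡ Iz (mod-sym (geom-≡1 N (r^-cong Jz≡0)))) (proj₂ (pow≈e⇒ Jz Iz N (proj₂ (K-p _ z∈K))))
      Iz≡0 : Iz ≡ + 0 [mod m′ ]
      Iz≡0 = invertible-cancel-≡0 (pᵏ-invertible k′ p∤m′) (mod-∣ m′∣m IzN≡0)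
      i≡0 : i ≡ + 0 [mod m′ ]
      i≡0 = invertible-cancel-≡0 (invertible-∣ m′∣m (r^-invertible ((n ℕ.∸ 1) ℕ.* j))) (mod-respˡ (ℤP.+-identityʳ _) Iz≡0)

    -- Any two nontrivial subgroups of a cyclic p-group meet, but ⟨b^{n′}⟩ ∩ ⟨a^{m′}⟩ = 1.
    notCyclic : 1 ℕ.≤ μ → 1 ℕ.≤ ν → + (r ^ n′) ≡ + 1 [mod p ] → ¬ IsCyclic subgroup
    notCyclic μ≥1 ν≥1 rⁿ′≡1 ((j , .(+ 0 + î * + m′)) , (j≡0@(by-multiple ĵ j≡ĵn′) , by-multiple î refl) , generates) =
      prime≢1 pp (ℕD.∣1⇒≡1 (≡0⇒∣ 1≡0))
      where
      instance
        _ : NonZero n′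
        _ = ℕP.m*n≢0⇒n≢0 (p ^ ν) {{subst NonZero n≡pᵛn′ it}}
        _ : NonZero m′
        _ = ℕP.m*n≢0⇒n≢0 (p ^ μ) {{subst NonZero m≡pᵘm′ it}}
      i : ℤ
      i = + 0 + î * + m′
      p∣pᵏ : ∀ k → 1 ℕ.≤ k → p ∣ p ^ k
      p∣pᵏ (suc k) _ = ℕD.m∣m*n (p ^ k)

      b-exponent : ∀ {x} k → + (x ℕ.* n′) ≡ + (k ℕ.* j) [mod n ] → + x ≡ + k * ĵ [mod p ]
      b-exponent {x} k eq = mod-∣ (p∣pᵏ ν ν≥1) (mod-/ {n′} {p ^ ν} (subst (λ d → _ ≡ _ [mod d ]) n≡pᵛn′
        (mod-respˡ (ℤP.pos-* x n′) (mod-respʳ (trans (ℤP.pos-* k j) (trans (cong (+ k *_) j≡ĵn′) (l (+ k) ĵ (+ n′)))) eq))))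
        where
        l : ∀ k ĵ n′ → k * (+ 0 + ĵ * n′) ≡ (k * ĵ) * n′
        l = solve-∀

      a-exponent : ∀ {x} k → x * + m′ ≡ i * + geom (r ^ j) k [mod m ] → x ≡ î * + k [mod p ]
      a-exponent {x} k eq = mod-trans
        (mod-∣ (p∣pᵏ μ μ≥1) (mod-/ {m′} {p ^ μ} (subst (λ d → _ ≡ _ [mod d ]) m≡pᵘm′ (mod-respʳ (l î (+ m′) _) eq))))
        (mod-*ˡ î (geom-≡1 k (r^-≡1-mod-p rⁿ′≡1 j j≡0)))
        where
        l : ∀ î m′ s → (+ 0 + î * m′) * s ≡ (î * s) * m′
        l = solve-∀

      power-of-g : ∀ h → InBlock h → ∃ λ k → h ≅ (k ℕ.* j , i * + geom (r ^ j) k)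
      power-of-g h h∈H =
        let k , h≈gᵏ = generates h h∈H in k , ≅-trans (≈⇒≅ {h} {pow _ k} h≈gᵏ) (≅-reflexive (pow-≡ j i k))

      bⁿ′ : ∃ λ k → (n′ , + 0) ≅ (k ℕ.* j , i * + geom (r ^ j) k)
      bⁿ′ = power-of-g (n′ , + 0) (∣⇒≡0 ℕD.∣-refl , mod-refl)

      aᵐ′ : ∃ λ k → (0 , + m′) ≅ (k ℕ.* j , i * + geom (r ^ j) k)
      aᵐ′ = power-of-g (0 , + m′) (mod-refl , ∣⇒≡0 ℕD.∣-refl)

      k₁ k₂ : ℕ
      k₁ = proj₁ bⁿ′
      k₂ = proj₁ aᵐ′

      1≡k₁ĵ : + 1 ≡ + k₁ * ĵ [mod p ]
      1≡k₁ĵ = b-exponent k₁ (mod-respˡ (cong +_ (sym (ℕP.*-identityˡ n′))) (proj₁ (proj₂ bⁿ′)))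

      0≡îk₁ : + 0 ≡ î * + k₁ [mod p ]
      0≡îk₁ = a-exponent k₁ (proj₂ (proj₂ bⁿ′))

      1≡îk₂ : + 1 ≡ î * + k₂ [mod p ]
      1≡îk₂ = a-exponent k₂ (mod-respˡ (sym (ℤP.*-identityˡ (+ m′))) (proj₂ (proj₂ aᵐ′)))

      î≡0 : î ≡ + 0 [mod p ]
      î≡0 = begin
        î                ≡⟨ ℤP.*-identityʳ î ⟨
        î * + 1          ≈⟨ mod-*ˡ î 1≡k₁ĵ ⟩
        î * (+ k₁ * ĵ)   ≡⟨ ℤP.*-assoc î (+ k₁) ĵ ⟨
        î * + k₁ * ĵ     ≈⟨ mod-*ʳ ĵ 0≡îk₁ ⟨
        + 0 * ĵ          ≡⟨ ℤP.*-zeroˡ ĵ ⟩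
        + 0              ∎
        where open mod-Reasoning p

      1≡0 : + 1 ≡ + 0 [mod p ]
      1≡0 = mod-trans 1≡îk₂ (mod-respʳ (ℤP.*-zeroˡ (+ k₂)) (mod-*ʳ (+ k₂) î≡0))

  AllSylowCyclic : Set₁
  AllSylowCyclic = ∀ p → Prime p → ∀ H → IsSylow p H → IsCyclic H

  sylow-cyclic⇒r^p′-part≢1 : AllSylowCyclic → ∀ {p μ m′ ν n′} → Prime p →
    m ≡ p ^ μ ℕ.* m′ → ¬ p ∣ m′ → 1 ℕ.≤ μ → n ≡ p ^ ν ℕ.* n′ → ¬ p ∣ n′ → 1 ℕ.≤ ν →
    ¬ (+ (r ^ n′) ≡ + 1 [mod p ])
  sylow-cyclic⇒r^p′-part≢1 sylow-cyclic {μ = μ} {m′} {ν} {n′} pp m≡ p∤m′ μ≥1 n≡ p∤n′ ν≥1 rⁿ′≡1 =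
    notCyclic μ≥1 ν≥1 rⁿ′≡1 (sylow-cyclic _ pp subgroup (isPSubgroup rⁿ′≡1 , isMaximal))
    where open SylowBlock pp {μ} {m′} {ν} {n′} m≡ p∤m′ n≡ p∤n′

  module NonAbelian (r≢1 : ¬ (+ r ≡ + 1 [mod m ])) where

    1<m : 1 ℕ.< m
    1<m = l m r≢1
      where
      l : ∀ d .{{_ : NonZero d}} → ¬ (+ r ≡ + 1 [mod d ]) → 1 ℕ.< d
      l (suc zero)    r≢1[1] = ⊥-elim (r≢1[1] (mod-1 (+ r) (+ 1)))
      l (suc (suc _)) _      = ℕ.s≤s (ℕ.s≤s ℕ.z≤n)

    1≢0-mod-m : ¬ (+ 1 ≡ + 0 [mod m ])
    1≢0-mod-m 1≡0 = ℕP.<-irrefl (sym (ℕD.∣1⇒≡1 (≡0⇒∣ 1≡0))) 1<m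

    0<r : 0 ℕ.< r
    0<r = l r rⁿ≡1
      where
      l : ∀ x → + (x ^ n) ≡ + 1 [mod m ] → 0 ℕ.< x
      l zero    0ⁿ≡1 = ⊥-elim (1≢0-mod-m (mod-sym (mod-respˡ (cong (λ k → + (0 ^ k)) (sym 1+[n∸1]≡n)) 0ⁿ≡1)))
      l (suc _) _    = ℕ.s≤s ℕ.z≤n

    r∸1≡r-1 : + (r ℕ.∸ 1) ≡ + r - + 1
    r∸1≡r-1 = trans (sym (ℤP.⊖-≥ 0<r)) (sym (ℤP.m-n≡m⊖n r 1))

    1<n : 1 ℕ.< n
    1<n = l n rⁿ≡1
      where
      l : ∀ d .{{_ : NonZero d}} → + (r ^ d) ≡ + 1 [mod m ] → 1 ℕ.< d
      l (suc zero)    r¹≡1 = ⊥-elim (r≢1 (mod-respˡ (cong +_ (ℕP.*-identityʳ r)) r¹≡1))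
      l (suc (suc _)) _    = ℕ.s≤s (ℕ.s≤s ℕ.z≤n)

    module Indecomposable (sylow-cyclic : AllSylowCyclic) (indecomposable : NotDirectProduct) where

      prime∣m,n⇒prime∤r∸1 : ∀ {p} → Prime p → p ∣ m → p ∣ n → ¬ p ∣ r ℕ.∸ 1
      prime∣m,n⇒prime∤r∸1 pp p∣m p∣n p∣r∸1 =
        let μ , m′ , m≡pᵘm′ , p∤m′ = p-part pp m
            ν , n′ , n≡pᵛn′ , p∤n′ = p-part pp n
        in sylow-cyclic⇒r^p′-part≢1 sylow-cyclic {μ = μ} {ν = ν} pp
             m≡pᵘm′ p∤m′ (p-part-exponent-≥1 {μ = μ} p∣m m≡pᵘm′ p∤m′)
             n≡pᵛn′ p∤n′ (p-part-exponent-≥1 {μ = ν} p∣n n≡pᵛn′ p∤n′) (^-≡1 n′ (∣∸1⇒≡1 0<r p∣r∸1))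

      prime∣m∤n⇒prime∤r∸1 : ∀ {p μ m′} → Prime p → m ≡ p ^ μ ℕ.* m′ → ¬ p ∣ m′ → 1 ℕ.≤ μ → ¬ p ∣ n → ¬ p ∣ r ℕ.∸ 1
      prime∣m∤n⇒prime∤r∸1 {p} {μ} {m′} pp m≡pᵘm′ p∤m′ μ≥1 p∤n p∣r∸1 =
        indecomposable H.subgroup K.subgroup (H.nonTrivial (inj₂ m′<m)) (K.nonTrivial (inj₁ 1<n))
          (isDirectProduct ℕD.∣-refl m′∣m (ℕD.1∣ n) pᵘ∣m
            (λ j j≡0 → mod-∣ m′∣m (r^-cong j≡0)) (λ j _ → ^-≡1 j r≡1[pᵘ])
            (invertible-mod-1 (+ n)) (prime∤⇒invertible-mod-^ μ pp p∤m′)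
            (ℕP.*-identityʳ n) (trans (ℕP.*-comm m′ (p ^ μ)) (sym m≡pᵘm′)))
        where
        m′∣m : m′ ∣ m
        m′∣m = divides (p ^ μ) m≡pᵘm′
        pᵘ∣m : p ^ μ ∣ m
        pᵘ∣m = divides m′ (trans m≡pᵘm′ (ℕP.*-comm (p ^ μ) m′))
        m′<m : m′ ℕ.< m
        m′<m = subst (m′ ℕ.<_) (sym m≡pᵘm′) (p-part-< pp μ≥1 {{ℕP.m*n≢0⇒n≢0 (p ^ μ) {{subst NonZero m≡pᵘm′ it}}}})
        module H = Block n m′ ℕD.∣-refl m′∣m
        module K = Block 1 (p ^ μ) (ℕD.1∣ n) pᵘ∣m
        -- r ≡ 1 (mod p) makes 1 + r + ⋯ + r^{n-1} ≡ n a unit mod p^μ, and r^n − 1 = (r − 1)(1 + r + ⋯ + r^{n-1}).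
        r≡1[pᵘ] : + r ≡ + 1 [mod p ^ μ ]
        r≡1[pᵘ] = mod-+-cancelʳ (- + 1) (mod-respʳ (sym (ℤP.+-inverseʳ (+ 1)))
          (invertible-cancel-≡0 geom-invertible (mod-respˡ (sym (geom-telescope r n)) (mod-+ (mod-∣ pᵘ∣m rⁿ≡1) (mod-refl {x = - + 1})))))
          where
          p∤geom : ¬ p ∣ geom r n
          p∤geom p∣geom = p∤n (≡0⇒∣ (mod-trans (mod-sym (geom-≡1 n (∣∸1⇒≡1 0<r p∣r∸1))) (∣⇒≡0 p∣geom)))
          geom-invertible : Invertible (p ^ μ) (+ geom r n)
          geom-invertible = prime∤⇒invertible-mod-^ μ pp p∤geom

      prime∣m⇒prime∤r∸1 : ∀ p → Prime p → p ∣ m → ¬ p ∣ r ℕ.∸ 1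
      prime∣m⇒prime∤r∸1 p pp p∣m =
        let μ , m′ , m≡pᵘm′ , p∤m′ = p-part pp m
        in [ prime∣m,n⇒prime∤r∸1 pp p∣m
           , prime∣m∤n⇒prime∤r∸1 pp m≡pᵘm′ p∤m′ (p-part-exponent-≥1 {μ = μ} p∣m m≡pᵘm′ p∤m′)
           ]′ (toSum (p ∣? n))

      r∸1-invertible : Invertible m (+ r - + 1)
      r∸1-invertible = subst (Invertible m) r∸1≡r-1
        (no-common-prime⇒invertible (λ p pp p∣r∸1 p∣m → prime∣m⇒prime∤r∸1 p pp p∣m p∣r∸1))

      geom-r-n≡0 : + geom r n ≡ + 0 [mod m ]
      geom-r-n≡0 = invertible-cancel-≡0 r∸1-invertible (begin
        + geom r n * (+ r - + 1)   ≡⟨ ℤP.*-comm (+ geom r n) _ ⟩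
        (+ r - + 1) * + geom r n   ≡⟨ geom-telescope r n ⟩
        + (r ^ n) - + 1            ≈⟨ mod-+ rⁿ≡1 (mod-refl {x = - + 1}) ⟩
        + 1 - + 1                  ≡⟨ ℤP.+-inverseʳ (+ 1) ⟩
        + 0                        ∎)
        where open mod-Reasoning m

      ab≅ba^r : a ∙ b ≅ b ∙ pow a r
      ab≅ba^r rewrite pow-a r = mod-refl , mod-reflexive (trans (ℤP.+-identityʳ _)
        (trans (ℤP.*-identityˡ (+ (r ℕ.* 1))) (cong +_ (ℕP.*-identityʳ r))))

      module Automorphism {σ : Carrier → Carrier} (σ-aut : IsAut σ) where

        open IsAut σ-aut
        open HomProperties isHom

        σ-relation : σ a ∙ σ b ≅ σ b ∙ pow (σ a) r
        σ-relation = begin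
          σ a ∙ σ b             ≈⟨ σ-hom a b ⟨
          σ (a ∙ b)             ≈⟨ σ-cong ab≅ba^r ⟩
          σ (b ∙ pow a r)       ≈⟨ σ-hom b (pow a r) ⟩
          σ b ∙ σ (pow a r)     ≈⟨ ∙-cong (≅-refl {σ b}) (σ-pow a r) ⟩
          σ b ∙ pow (σ a) r     ∎
          where open ≅-Reasoning

        k₀ : ℕ
        k₀ = proj₁ (σ a)

        kb : ℕ
        kb = proj₁ (σ b)

        [r-1]k₀≡0 : (+ r - + 1) * + k₀ ≡ + 0 [mod n ]
        [r-1]k₀≡0 = begin
          (+ r - + 1) * + k₀                    ≡⟨ l (+ r) (+ k₀) (+ kb) ⟩
          (+ kb + + r * + k₀) - (+ k₀ + + kb)   ≡⟨ cong₂ _-_ (trans (ℤP.pos-+ kb (r ℕ.* k₀)) (cong (_+_ (+ kb)) (ℤP.pos-* r k₀))) (ℤP.pos-+ k₀ kb) ⟨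
          + (kb ℕ.+ r ℕ.* k₀) - + (k₀ ℕ.+ kb)   ≈⟨ mod-+ b-exponents (mod-refl {x = - + (k₀ ℕ.+ kb)}) ⟨
          + (k₀ ℕ.+ kb) - + (k₀ ℕ.+ kb)         ≡⟨ ℤP.+-inverseʳ (+ (k₀ ℕ.+ kb)) ⟩
          + 0                                   ∎
          where
          open mod-Reasoning n
          b-exponents : + (k₀ ℕ.+ kb) ≡ + (kb ℕ.+ r ℕ.* k₀) [mod n ]
          b-exponents = proj₁ (≅-trans σ-relation (∙-cong (≅-refl {σ b}) (≅-reflexive (pow-≡ k₀ (proj₂ (σ a)) r))))
          l : ∀ r k₀ kb → (r - + 1) * k₀ ≡ (kb + r * k₀) - (k₀ + kb)
          l = solve-∀

        mk₀≡0 : + m * + k₀ ≡ + 0 [mod n ]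
        mk₀≡0 = mod-respˡ (ℤP.pos-* m k₀) (proj₁ (begin
          (m ℕ.* k₀ , _)       ≡⟨ pow-≡ k₀ (proj₂ (σ a)) m ⟨
          pow (σ a) m          ≈⟨ σ-pow a m ⟨
          σ (pow a m)          ≈⟨ σ-cong (≅-trans (≅-reflexive (pow-a m)) (mod-refl , ∣⇒≡0 ℕD.∣-refl)) ⟩
          σ e                  ≈⟨ σ-e ⟩
          e                    ∎))
          where open ≅-Reasoning

        σa-in-⟨a⟩ : + k₀ ≡ + 0 [mod n ]
        σa-in-⟨a⟩ = coprime-annihilators⇒≡0 r∸1-invertible [r-1]k₀≡0 mk₀≡0

        s : ℕ
        s = proj₂ (σ a) %ℕ m

        σa≅aˢ : σ a ≅ (0 , + s)
        σa≅aˢ = σa-in-⟨a⟩ , mod-%ℕ m (proj₂ (σ a))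

        s-coprime : Coprime s m
        s-coprime {d} (d∣s , divides m₁ m≡m₁d) =
          ℕP.*-cancelˡ-≡ d 1 m (trans (cong (ℕ._* d) (sym m₁≡m)) (trans (sym m≡m₁d) (sym (ℕP.*-identityʳ m))))
          where
          s₁ : ℕ
          s₁ = ℕD.quotient d∣s
          sm₁≡0 : + (s ℕ.* m₁) ≡ + 0 [mod m ]
          sm₁≡0 = ∣⇒≡0 (divides s₁ (trans (cong (ℕ._* m₁) (ℕD.m∣n⇒n≡quotient*m d∣s))
                    (trans (ℕP.*-assoc s₁ d m₁) (cong (s₁ ℕ.*_) (trans (ℕP.*-comm d m₁) (sym m≡m₁d))))))
          σaᵐ¹≅σe : σ (pow a m₁) ≅ σ e
          σaᵐ¹≅σe = begin
            σ (pow a m₁)                          ≈⟨ σ-pow a m₁ ⟩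
            pow (σ a) m₁                          ≈⟨ pow-cong m₁ σa≅aˢ ⟩
            pow (0 , + s) m₁                      ≡⟨ pow-≡ 0 (+ s) m₁ ⟩
            (m₁ ℕ.* 0 , + s * + geom (r ^ 0) m₁)  ≈⟨ mod-reflexive (cong +_ (ℕP.*-zeroʳ m₁)) ,
                                                     mod-trans (mod-reflexive (trans (cong (λ z → + s * + z) (geom-1 m₁)) (sym (ℤP.pos-* s m₁)))) sm₁≡0 ⟩
            e                                     ≈⟨ σ-e ⟨
            σ e                                   ∎
            where open ≅-Reasoning
          m∣m₁ : m ∣ m₁
          m∣m₁ = ≡0⇒∣ (proj₂ (≅-trans (≅-sym (≅-reflexive (pow-a m₁))) (≈⇒≅ (injective (≅⇒≈ σaᵐ¹≅σe)))))
          m₁≢0 : m₁ ≢ 0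
          m₁≢0 refl = ℕ.≢-nonZero⁻¹ m m≡m₁d
          m₁≡m : m₁ ≡ m
          m₁≡m = ℕP.≤-antisym (ℕD.∣⇒≤ (divides d (trans m≡m₁d (ℕP.*-comm m₁ d)))) (ℕD.∣⇒≤ {{ℕ.≢-nonZero m₁≢0}} m∣m₁)

        s-invertible : Invertible m (+ s)
        s-invertible = coprime⇒invertible s-coprime

        1≤s : 1 ℕ.≤ s
        1≤s = coprime⇒≢0 1<m s-coprime

        r^kb≡r : r^ kb ≡ + r [mod m ]
        r^kb≡r = invertible-cancelʳ s-invertible (mod-respˡ (ℤP.*-comm (+ s) (r^ kb)) (mod-respʳ (ℤP.*-comm (+ s) (+ r))
          (mod-+-cancelʳ ub (mod-respʳ a-exponents≡ (proj₂ a-exponents)))))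
          where
          ub : ℤ
          ub = proj₂ (σ b)
          a-exponents : (0 , + s) ∙ σ b ≅ σ b ∙ pow (0 , + s) r
          a-exponents = begin
            (0 , + s) ∙ σ b     ≈⟨ ∙-cong σa≅aˢ (≅-refl {σ b}) ⟨
            σ a ∙ σ b           ≈⟨ σ-relation ⟩
            σ b ∙ pow (σ a) r   ≈⟨ ∙-cong (≅-refl {σ b}) (pow-cong r σa≅aˢ) ⟩
            σ b ∙ pow (0 , + s) r ∎
            where open ≅-Reasoning
          a-exponents≡ : proj₂ (σ b ∙ pow (0 , + s) r) ≡ + s * + r + ub
          a-exponents≡ = begin
            proj₂ (σ b ∙ pow (0 , + s) r)                    ≡⟨ cong (λ x → proj₂ (σ b ∙ x)) (pow-≡ 0 (+ s) r) ⟩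
            ub * r^ (r ℕ.* 0) + + s * + geom (r ^ 0) r        ≡⟨ cong₂ (λ k g → ub * r^ k + + s * + g) (ℕP.*-zeroʳ r) (geom-1 r) ⟩
            ub * + 1 + + s * + r                              ≡⟨ cong (_+ + s * + r) (ℤP.*-identityʳ ub) ⟩
            ub + + s * + r                                    ≡⟨ ℤP.+-comm ub (+ s * + r) ⟩
            + s * + r + ub                                    ∎
            where open ≡-Reasoning

      module Order {n₀ : ℕ} .{{_ : NonZero n₀}} (rⁿ⁰≡1 : + (r ^ n₀) ≡ + 1 [mod m ])
                   (minimal : ∀ k → 1 ℕ.≤ k → + (r ^ k) ≡ + 1 [mod m ] → n₀ ℕ.≤ k) where

        r^≡1⇒n₀∣ : ∀ k → r^ k ≡ + 1 [mod m ] → n₀ ∣ k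
        r^≡1⇒n₀∣ = order-∣ rⁿ⁰≡1 minimal

        n₀∣⇒r^≡1 : ∀ {k} → n₀ ∣ k → r^ k ≡ + 1 [mod m ]
        n₀∣⇒r^≡1 (divides q refl) = ^-multiple-≡1 q rⁿ⁰≡1

        n₀∣n : n₀ ∣ n
        n₀∣n = r^≡1⇒n₀∣ n rⁿ≡1

        r^-cong-n₀ : ∀ {k k′} → + k ≡ + k′ [mod n₀ ] → r^ k ≡ r^ k′ [mod m ]
        r^-cong-n₀ = ^-period rⁿ⁰≡1

        prime∣m⇒n₀∤q′-part : ∀ {q ν n′} → Prime q → n ≡ q ^ ν ℕ.* n′ → ¬ q ∣ n′ → 1 ℕ.≤ ν → q ∣ m → ¬ n₀ ∣ n′
        prime∣m⇒n₀∤q′-part {ν = ν} pq n≡qᵛn′ q∤n′ ν≥1 q∣m n₀∣n′ =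
          let μ , m′ , m≡qᵘm′ , q∤m′ = p-part pq m
          in sylow-cyclic⇒r^p′-part≢1 sylow-cyclic {μ = μ} {ν = ν} pq
               m≡qᵘm′ q∤m′ (p-part-exponent-≥1 {μ = μ} q∣m m≡qᵘm′ q∤m′) n≡qᵛn′ q∤n′ ν≥1 (mod-∣ q∣m (n₀∣⇒r^≡1 n₀∣n′))

        prime∤m⇒n₀∤q′-part : ∀ {q ν n′} → Prime q → n ≡ q ^ ν ℕ.* n′ → ¬ q ∣ n′ → 1 ℕ.≤ ν → ¬ q ∣ m → ¬ n₀ ∣ n′
        prime∤m⇒n₀∤q′-part {q} {ν} {n′} pq n≡qᵛn′ q∤n′ ν≥1 q∤m n₀∣n′ =
          indecomposable H.subgroup K.subgroup (H.nonTrivial (inj₁ n′<n)) (K.nonTrivial (inj₂ 1<m))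
            (isDirectProduct n′∣n ℕD.∣-refl qᵛ∣n (ℕD.1∣ m)
              (λ j j≡0 → n₀∣⇒r^≡1 (ℕD.∣-trans n₀∣n′ (≡0⇒∣ j≡0))) (λ j _ → mod-1 _ _)
              (prime∤⇒invertible-mod-^ ν pq q∤n′) (invertible-mod-1 (+ m))
              (trans (ℕP.*-comm n′ (q ^ ν)) (sym n≡qᵛn′)) (ℕP.*-identityʳ m))
          where
          n′∣n : n′ ∣ n
          n′∣n = divides (q ^ ν) n≡qᵛn′
          qᵛ∣n : q ^ ν ∣ n
          qᵛ∣n = divides n′ (trans n≡qᵛn′ (ℕP.*-comm (q ^ ν) n′))
          n′<n : n′ ℕ.< n
          n′<n = subst (n′ ℕ.<_) (sym n≡qᵛn′) (p-part-< pq ν≥1 {{ℕP.m*n≢0⇒n≢0 (q ^ ν) {{subst NonZero n≡qᵛn′ it}}}})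
          module H = Block n′ m n′∣n ℕD.∣-refl
          module K = Block (q ^ ν) 1 qᵛ∣n (ℕD.1∣ m)

        q∤n₀⇒n₀∣q′-part : ∀ {q ν n′} → Prime q → n ≡ q ^ ν ℕ.* n′ → ¬ q ∣ n₀ → n₀ ∣ n′
        q∤n₀⇒n₀∣q′-part {q} {ν} {n′} pq n≡qᵛn′ q∤n₀ = ≡0⇒∣ (invertible-cancel-≡0 {x = + n′}
          (invertible-^ ν (prime∤⇒prime-invertible pq q∤n₀))
          (mod-respˡ (trans (cong +_ n≡qᵛn′) (trans (ℤP.pos-* (q ^ ν) n′) (ℤP.*-comm (+ (q ^ ν)) (+ n′)))) (∣⇒≡0 n₀∣n)))

        prime∣n⇒prime∣n₀ : ∀ q → Prime q → q ∣ n → q ∣ n₀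
        prime∣n⇒prime∣n₀ q pq q∣n = decidable-stable (q ∣? n₀) λ q∤n₀ →
          let ν , n′ , n≡qᵛn′ , q∤n′ = p-part pq n
              ν≥1 : 1 ℕ.≤ ν
              ν≥1 = p-part-exponent-≥1 {μ = ν} q∣n n≡qᵛn′ q∤n′
          in [ prime∣m⇒n₀∤q′-part pq n≡qᵛn′ q∤n′ ν≥1 , prime∤m⇒n₀∤q′-part pq n≡qᵛn′ q∤n′ ν≥1 ]′
               (toSum (q ∣? m)) (q∤n₀⇒n₀∣q′-part {ν = ν} pq n≡qᵛn′ q∤n₀)

        ≡1-mod-n₀⇒invertible-mod-n : ∀ {K} → + K ≡ + 1 [mod n₀ ] → Invertible n (+ K)
        ≡1-mod-n₀⇒invertible-mod-n K≡1 = no-common-prime⇒invertible λ q pq q∣K q∣n →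
          prime≢1 pq (ℕD.∣1⇒≡1 (≡0⇒∣ (mod-trans (mod-sym (mod-∣ (prime∣n⇒prime∣n₀ q pq q∣n) K≡1)) (∣⇒≡0 q∣K))))

        odd⇒2-invertible-mod-n₀ : ¬ 2 ∣ m ℕ.* n → Invertible n₀ (+ 2)
        odd⇒2-invertible-mod-n₀ odd = no-common-prime⇒invertible λ q pq q∣2 q∣n₀ →
          odd (ℕD.∣-trans (subst (_∣ n₀) (prime∣prime⇒≡ pq prime[2] q∣2) q∣n₀) (ℕD.∣-trans n₀∣n (ℕD.n∣m*n m)))

        geom-cong : ∀ {J J′} → + J ≡ + J′ [mod n ] → + geom r J ≡ + geom r J′ [mod m ]
        geom-cong = geom-period geom-r-n≡0

        -- On normal forms b^J a^I, the endomorphism with b ↦ b^K a^U and a ↦ a^s.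
        φ : ℕ → ℤ → ℕ → Carrier → Carrier
        φ K U s (J , I) = (J ℕ.* K , U * + geom r J + + s * I)

        module Endomorphism {K : ℕ} (U : ℤ) (s : ℕ) (K≡1 : + K ≡ + 1 [mod n₀ ]) where

          r^JK≡r^J : ∀ J → r^ (J ℕ.* K) ≡ r^ J [mod m ]
          r^JK≡r^J J = r^-cong-n₀ (mod-respˡ (sym (ℤP.pos-* J K)) (mod-respʳ (ℤP.*-identityʳ (+ J)) (mod-*ˡ (+ J) K≡1)))

          φ-cong : ∀ {x y} → x ≅ y → φ K U s x ≅ φ K U s y
          φ-cong {J , _} {J′ , _} (p , q) =
            mod-respˡ (sym (ℤP.pos-* J K)) (mod-respʳ (sym (ℤP.pos-* J′ K)) (mod-*ʳ (+ K) p)) ,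
            mod-+ (mod-*ˡ U (geom-cong p)) (mod-*ˡ (+ s) q)

          φ-hom : ∀ x y → φ K U s (x ∙ y) ≅ φ K U s x ∙ φ K U s y
          φ-hom (J , I) (J′ , I′) = mod-reflexive (cong +_ (ℕP.*-distribʳ-+ K J J′)) , (begin
            U * + geom r (J ℕ.+ J′) + + s * (I * r^ J′ + I′)
              ≡⟨ cong (λ z → U * z + + s * (I * r^ J′ + I′)) geom-J+J′ ⟩
            U * (+ geom r J′ + r^ J′ * + geom r J) + + s * (I * r^ J′ + I′)
              ≡⟨ l U (+ geom r J′) (r^ J′) (+ geom r J) (+ s) I I′ ⟩
            (U * + geom r J + + s * I) * r^ J′ + (U * + geom r J′ + + s * I′)
              ≈⟨ mod-+ (mod-*ˡ (U * + geom r J + + s * I) (r^JK≡r^J J′)) mod-refl ⟨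
            (U * + geom r J + + s * I) * r^ (J′ ℕ.* K) + (U * + geom r J′ + + s * I′)
              ∎)
            where
            open mod-Reasoning m
            geom-J+J′ : + geom r (J ℕ.+ J′) ≡ + geom r J′ + r^ J′ * + geom r J
            geom-J+J′ = trans (cong (λ z → + geom r z) (ℕP.+-comm J J′))
              (trans (cong +_ (geom-+ r J′ J)) (trans (ℤP.pos-+ (geom r J′) _) (cong (_+_ (+ geom r J′)) (ℤP.pos-* (r ^ J′) (geom r J)))))
            l : ∀ U S′ R S s I I′ → U * (S′ + R * S) + s * (I * R + I′) ≡ (U * S + s * I) * R + (U * S′ + s * I′)
            l = solve-∀

          determined-by-generators : ∀ {σ} → IsHom σ → σ a ≅ (0 , + s) → σ b ≅ (K , U) → ∀ x → σ x ≅ φ K U s x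
          determined-by-generators {σ} σ-isHom σa≅aˢ σb≅bᴷaᵁ (J , I) = begin
            σ (J , I)                                  ≈⟨ σ-cong (normal-form J I) ⟩
            σ (pow b J ∙ pow a I′)                     ≈⟨ σ-hom (pow b J) (pow a I′) ⟩
            σ (pow b J) ∙ σ (pow a I′)                 ≈⟨ ∙-cong (σ-pow b J) (σ-pow a I′) ⟩
            pow (σ b) J ∙ pow (σ a) I′                 ≈⟨ ∙-cong (pow-cong J σb≅bᴷaᵁ) (pow-cong I′ σa≅aˢ) ⟩
            pow (K , U) J ∙ pow (0 , + s) I′           ≡⟨ cong₂ _∙_ (pow-≡ K U J) (pow-≡ 0 (+ s) I′) ⟩
            (J ℕ.* K , U * + geom (r ^ K) J) ∙ (I′ ℕ.* 0 , + s * + geom (r ^ 0) I′)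
                                                       ≈⟨ mod-reflexive (cong +_ (trans (cong (J ℕ.* K ℕ.+_) (ℕP.*-zeroʳ I′)) (ℕP.+-identityʳ _))) ,
                                                          mod-respˡ (sym a-exponent≡) (mod-+ (mod-*ˡ U (geom-mod J r^K≡r)) (mod-*ˡ (+ s) (mod-sym (mod-%ℕ m I)))) ⟩
            φ K U s (J , I)                            ∎
            where
            open ≅-Reasoning
            open HomProperties σ-isHom
            I′ : ℕ
            I′ = I %ℕ m
            r^K≡r : + (r ^ K) ≡ + r [mod m ]
            r^K≡r = mod-respˡ (cong r^_ (ℕP.*-identityˡ K)) (mod-respʳ (cong +_ (ℕP.*-identityʳ r)) (r^JK≡r^J 1))
            a-exponent≡ : U * + geom (r ^ K) J * r^ (I′ ℕ.* 0) + + s * + geom (r ^ 0) I′ ≡ U * + geom (r ^ K) J + + s * + I′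
            a-exponent≡ = cong₂ _+_ (trans (cong (λ z → U * + geom (r ^ K) J * r^ z) (ℕP.*-zeroʳ I′)) (ℤP.*-identityʳ (U * + geom (r ^ K) J)))
                                    (cong (λ z → + s * + z) (geom-1 I′))

          module _ (K-invertible : Invertible n (+ K)) (s-invertible : Invertible m (+ s)) where

            φ-injective : ∀ {x y} → φ K U s x ≅ φ K U s y → x ≅ y
            φ-injective {J , I} {J′ , I′} (p , q) = J≡J′ ,
              invertible-cancelʳ s-invertible (mod-respˡ (ℤP.*-comm (+ s) I) (mod-respʳ (ℤP.*-comm (+ s) I′)
                (mod-+-cancelˡ (mod-*ˡ U (geom-cong J≡J′)) q)))
              where
              J≡J′ : + J ≡ + J′ [mod n ]
              J≡J′ = invertible-cancelʳ K-invertible (mod-respˡ (ℤP.pos-* J K) (mod-respʳ (ℤP.pos-* J′ K) p))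

            φ-surjective : ∀ y → ∃ λ x → φ K U s x ≅ y
            φ-surjective (J′ , I′) = (J , I) , JK≡J′ , UgeomJ+sI≡I′
              where
              v w : ℤ
              v = proj₁ K-invertible
              w = proj₁ s-invertible
              J : ℕ
              J = (+ J′ * v) %ℕ n
              I : ℤ
              I = w * (I′ - U * + geom r J)
              JK≡J′ : + (J ℕ.* K) ≡ + J′ [mod n ]
              JK≡J′ = begin
                + (J ℕ.* K)        ≡⟨ ℤP.pos-* J K ⟩
                + J * + K          ≈⟨ mod-*ʳ (+ K) (mod-%ℕ n (+ J′ * v)) ⟨
                + J′ * v * + K     ≡⟨ ℤP.*-assoc (+ J′) v (+ K) ⟩
                + J′ * (v * + K)   ≈⟨ mod-*ˡ (+ J′) (proj₂ K-invertible) ⟩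
                + J′ * + 1         ≡⟨ ℤP.*-identityʳ (+ J′) ⟩
                + J′               ∎
                where open mod-Reasoning n
              UgeomJ+sI≡I′ : U * + geom r J + + s * I ≡ I′ [mod m ]
              UgeomJ+sI≡I′ = begin
                A + + s * (w * (I′ - A))   ≡⟨ l A (+ s) w I′ ⟩
                A + (w * + s) * (I′ - A)   ≈⟨ mod-+ (mod-refl {x = A}) (mod-*ʳ (I′ - A) (proj₂ s-invertible)) ⟩
                A + + 1 * (I′ - A)         ≡⟨ l′ A I′ ⟩
                I′                         ∎
                where
                open mod-Reasoning m
                A : ℤ
                A = U * + geom r J
                l : ∀ A s w B → A + s * (w * (B - A)) ≡ A + (w * s) * (B - A)
                l = solve-∀
                l′ : ∀ A B → A + + 1 * (B - A) ≡ B
                l′ = solve-∀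

            φ-isAut : IsAut (φ K U s)
            φ-isAut = record
              { isHom      = record { cong = λ x≈y → ≅⇒≈ (φ-cong (≈⇒≅ x≈y)) ; hom = λ x y → ≅⇒≈ (φ-hom x y) }
              ; injective  = λ φx≈φy → ≅⇒≈ (φ-injective (≈⇒≅ φx≈φy))
              ; surjective = λ y → proj₁ (φ-surjective y) , ≅⇒≈ (proj₂ (φ-surjective y))
              }

        1+ln₀≡1 : ∀ l → + (1 ℕ.+ l ℕ.* n₀) ≡ + 1 [mod n₀ ]
        1+ln₀≡1 l = by-multiple (+ l) (trans (ℤP.pos-+ 1 (l ℕ.* n₀)) (cong (_+_ (+ 1)) (ℤP.pos-* l n₀)))

        r^≡r⇒≡1+ln₀ : ∀ K → r^ K ≡ + r [mod m ] → K ℕ.< n → ∃ λ l → K ≡ 1 ℕ.+ l ℕ.* n₀ × l ℕ.< n ℕ./ n₀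
        r^≡r⇒≡1+ln₀ zero     r^0≡r _   = ⊥-elim (r≢1 (mod-sym r^0≡r))
        r^≡r⇒≡1+ln₀ (suc K′) r^K≡r K<n = l , cong suc K′≡ln₀ , l<n/n₀
          where
          n₀∣K′ : n₀ ∣ K′
          n₀∣K′ = r^≡1⇒n₀∣ K′ (invertible-cancelʳ r-invertible
            (mod-respˡ (trans (ℤP.pos-* r (r ^ K′)) (ℤP.*-comm (+ r) (r^ K′))) (mod-respʳ (sym (ℤP.*-identityˡ (+ r))) r^K≡r)))
          l : ℕ
          l = ℕD.quotient n₀∣K′
          K′≡ln₀ : K′ ≡ l ℕ.* n₀
          K′≡ln₀ = ℕD.m∣n⇒n≡quotient*m n₀∣K′
          l<n/n₀ : l ℕ.< n ℕ./ n₀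
          l<n/n₀ = ℕP.*-cancelʳ-< n₀ l (n ℕ./ n₀)
            (subst₂ ℕ._<_ K′≡ln₀ (sym (ℕM.m/n*n≡m n₀∣n)) (ℕP.<-trans (ℕP.n<1+n K′) K<n))

        HasStandardForm : (Carrier → Carrier) → Set
        HasStandardForm σ = ∃ λ s → ∃ λ t → ∃ λ l →
          (1 ℕ.≤ s × s ℕ.< m × gcd s m ≡ 1 × l ℕ.< n ℕ./ n₀ × 1 ℕ.≤ t × t ℕ.≤ m)
          × IsHom σ × σ a ≈ pow a s × σ b ≈ pow a t ∙ pow b (1 ℕ.+ l ℕ.* n₀)

        module AutomorphismShape {σ : Carrier → Carrier} (σ-aut : IsAut σ) where

          open Automorphism σ-aut public

          K : ℕ
          K = kb ℕ.% n

          r^K≡r : r^ K ≡ + r [mod m ]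
          r^K≡r = mod-trans (r^-cong (mod-sym (mod-%ℕ n (+ kb)))) r^kb≡r

          t-representative : ∃ λ t → 1 ℕ.≤ t × t ℕ.≤ m × + t ≡ proj₂ (σ b) * r^ ((n ℕ.∸ 1) ℕ.* K) [mod m ]
          t-representative = ∃-representative-1…d m (proj₂ (σ b) * r^ ((n ℕ.∸ 1) ℕ.* K))

          t : ℕ
          t = proj₁ t-representative

          σb≅aᵗbᴷ : σ b ≅ pow a t ∙ pow b K
          σb≅aᵗbᴷ = ≅-trans (mod-%ℕ n (+ kb) , ub≡tr^K) (≅-sym (≅-reflexive (cong₂ _∙_ (pow-a t) (pow-b K))))
            where
            ub : ℤ
            ub = proj₂ (σ b)
            ub≡tr^K : ub ≡ + t * r^ K + + 0 [mod m ]
            ub≡tr^K = begin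
              ub                                       ≡⟨ ℤP.*-identityʳ ub ⟨
              ub * + 1                                 ≈⟨ mod-*ˡ ub (r^-inverse K) ⟨
              ub * (r^ ((n ℕ.∸ 1) ℕ.* K) * r^ K)       ≡⟨ ℤP.*-assoc ub _ (r^ K) ⟨
              ub * r^ ((n ℕ.∸ 1) ℕ.* K) * r^ K         ≈⟨ mod-*ʳ (r^ K) (proj₂ (proj₂ (proj₂ t-representative))) ⟨
              + t * r^ K                               ≡⟨ ℤP.+-identityʳ (+ t * r^ K) ⟨
              + t * r^ K + + 0                         ∎
              where open mod-Reasoning m

          K≡1+ln₀ : ∃ λ l → K ≡ 1 ℕ.+ l ℕ.* n₀ × l ℕ.< n ℕ./ n₀
          K≡1+ln₀ = r^≡r⇒≡1+ln₀ K r^K≡r (ℕM.m%n<n kb n)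

          K≡1 : + K ≡ + 1 [mod n₀ ]
          K≡1 = let l , K≡ , _ = K≡1+ln₀ in mod-respˡ (cong +_ (sym K≡)) (1+ln₀≡1 l)

          hasStandardForm : HasStandardForm σ
          hasStandardForm =
            let l , K≡1+ln₀ , l<n/n₀ = K≡1+ln₀ in
            s , t , l , (1≤s , ℤD.n%ℕd<d (proj₂ (σ a)) m , ℕC.coprime⇒gcd≡1 s-coprime , l<n/n₀ ,
                         proj₁ (proj₂ t-representative) , proj₁ (proj₂ (proj₂ t-representative))) ,
            IsAut.isHom σ-aut , ≅⇒≈ (≅-trans σa≅aˢ (≅-sym (≅-reflexive (pow-a s)))) ,
            ≅⇒≈ (subst (λ k → σ b ≅ pow a t ∙ pow b k) K≡1+ln₀ σb≅aᵗbᴷ)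

        hasStandardForm⇒isAut : ∀ {σ} → HasStandardForm σ → IsAut σ
        hasStandardForm⇒isAut {σ} (s , t , l , (_ , _ , gcd≡1 , _ , _ , _) , σ-hom , σa≈aˢ , σb≈aᵗbᴷ) =
          isAut-resp σ-hom (determined-by-generators σ-hom σa≅ σb≅) (φ-isAut K-invertible (coprime⇒invertible (ℕC.gcd≡1⇒coprime gcd≡1)))
          where
          K : ℕ
          K = 1 ℕ.+ l ℕ.* n₀
          K-invertible : Invertible n (+ K)
          K-invertible = ≡1-mod-n₀⇒invertible-mod-n (1+ln₀≡1 l)
          open Endomorphism (+ t * r^ K + + 0) s (1+ln₀≡1 l)
          σa≅ : σ a ≅ (0 , + s)
          σa≅ = ≅-trans (≈⇒≅ σa≈aˢ) (≅-reflexive (pow-a s))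
          σb≅ : σ b ≅ (K , + t * r^ K + + 0)
          σb≅ = ≅-trans (≈⇒≅ σb≈aᵗbᴷ) (≅-reflexive (cong₂ _∙_ (pow-a t) (pow-b K)))

        -- A prime p ∣ m dividing 1 + r + ⋯ + r^{J-1} has r^J ≡ 1 (mod p), hence r ≡ 1 (mod p) as J is a unit mod n.
        geom-invertible : ∀ {J} → Invertible n (+ J) → Invertible m (+ geom r J)
        geom-invertible {J} (v , vJ≡1) = no-common-prime⇒invertible λ p pp p∣geom p∣m →
          prime∣m⇒prime∤r∸1 p pp p∣m (≡0⇒∣ (mod-respˡ (sym r∸1≡r-1)
            (mod-respʳ (ℤP.+-inverseʳ (+ 1)) (mod-+ (r≡1[p] p∣m p∣geom) (mod-refl {x = - + 1})))))
          where
          x : ℕ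
          x = v %ℕ n
          xJ≡1 : + (x ℕ.* J) ≡ + 1 [mod n ]
          xJ≡1 = mod-respˡ (sym (ℤP.pos-* x J)) (mod-trans (mod-*ʳ (+ J) (mod-sym (mod-%ℕ n v))) vJ≡1)
          r≡1[p] : ∀ {p} → p ∣ m → p ∣ geom r J → + r ≡ + 1 [mod p ]
          r≡1[p] {p} p∣m p∣geom = begin
            + r                      ≡⟨ cong +_ (ℕP.*-identityʳ r) ⟨
            r^ 1                     ≈⟨ mod-∣ p∣m (r^-cong xJ≡1) ⟨
            r^ (x ℕ.* J)             ≡⟨ cong r^_ (ℕP.*-comm x J) ⟩
            + (r ^ (J ℕ.* x))        ≡⟨ cong +_ (ℕP.^-*-assoc r J x) ⟨
            + ((r ^ J) ^ x)          ≈⟨ ^-≡1 x r^J≡1 ⟩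
            + 1                      ∎
            where
            open mod-Reasoning p
            r^J≡1 : + (r ^ J) ≡ + 1 [mod p ]
            r^J≡1 = mod-respˡ (l (+ (r ^ J))) (mod-respʳ (ℤP.+-identityˡ (+ 1)) (mod-+ (mod-respˡ (geom-telescope r J)
              (mod-respʳ (ℤP.*-zeroʳ (+ r - + 1)) (mod-*ˡ (+ r - + 1) (∣⇒≡0 p∣geom)))) (mod-refl {x = + 1})))
              where
              l : ∀ X → X - + 1 + + 1 ≡ X
              l = solve-∀

        ∃-aut[bʲ↦aᵗbʲ⁺ˡⁿ⁰] : ∀ (j t l : ℤ) → gcd ∣ j ∣ n ≡ 1 →
                             ∃ λ σ → IsAut σ × σ (powℤ b j) ≈ powℤ a t ∙ powℤ b (j + l * + n₀)
        ∃-aut[bʲ↦aᵗbʲ⁺ˡⁿ⁰] j t l gcd≡1 = φ K U 1 , φ-isAut K-invertible (+ 1 , mod-refl) , ≅⇒≈ σbʲ≅aᵗbʲ⁺ˡⁿ⁰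
          where
          J : ℕ
          J = j %ℕ n
          J-invertible : Invertible n (+ J)
          J-invertible = invertible-resp (mod-%ℕ n j) (invertible-∣∣ j (coprime⇒invertible (ℕC.gcd≡1⇒coprime gcd≡1)))
          v : ℤ
          v = proj₁ J-invertible
          L : ℕ
          L = (v * l) %ℕ n
          K : ℕ
          K = 1 ℕ.+ L ℕ.* n₀
          K-invertible : Invertible n (+ K)
          K-invertible = ≡1-mod-n₀⇒invertible-mod-n (1+ln₀≡1 L)
          w : ℤ
          w = proj₁ (geom-invertible J-invertible)
          J₂ : ℕ
          J₂ = (j + l * + n₀) %ℕ n
          U : ℤ
          U = t * r^ J₂ * w
          open Endomorphism U 1 (1+ln₀≡1 L)
          JL≡l : + J * + L ≡ l [mod n ]
          JL≡l = begin
            + J * + L         ≈⟨ mod-*ˡ (+ J) (mod-%ℕ n (v * l)) ⟨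
            + J * (v * l)     ≡⟨ l₂ (+ J) v l ⟩
            v * + J * l       ≈⟨ mod-*ʳ l (proj₂ J-invertible) ⟩
            + 1 * l           ≡⟨ ℤP.*-identityˡ l ⟩
            l                 ∎
            where
            open mod-Reasoning n
            l₂ : ∀ J v l → J * (v * l) ≡ v * J * l
            l₂ = solve-∀
          JK≡J₂ : + (J ℕ.* K) ≡ + J₂ [mod n ]
          JK≡J₂ = begin
            + (J ℕ.* K)                    ≡⟨ trans (ℤP.pos-* J K) (cong (+ J *_) (trans (ℤP.pos-+ 1 (L ℕ.* n₀)) (cong (_+_ (+ 1)) (ℤP.pos-* L n₀)))) ⟩
            + J * (+ 1 + + L * + n₀)       ≡⟨ l₁ (+ J) (+ L) (+ n₀) ⟩
            + J + + J * + L * + n₀         ≈⟨ mod-+ (mod-sym (mod-%ℕ n j)) (mod-*ʳ (+ n₀) JL≡l) ⟩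
            j + l * + n₀                   ≈⟨ mod-%ℕ n (j + l * + n₀) ⟩
            + J₂                           ∎
            where
            open mod-Reasoning n
            l₁ : ∀ J L N → J * (+ 1 + L * N) ≡ J + J * L * N
            l₁ = solve-∀
          a-exponent : U * + geom r J + + 1 * + 0 ≡ t * r^ J₂ + + 0 [mod m ]
          a-exponent = begin
            U * + geom r J + + 1 * + 0     ≡⟨ l₃ (t * r^ J₂) w (+ geom r J) ⟩
            t * r^ J₂ * (w * + geom r J) + + 0 ≈⟨ mod-+ (mod-*ˡ (t * r^ J₂) (proj₂ (geom-invertible J-invertible))) (mod-refl {x = + 0}) ⟩
            t * r^ J₂ * + 1 + + 0          ≡⟨ cong (_+ + 0) (ℤP.*-identityʳ (t * r^ J₂)) ⟩
            t * r^ J₂ + + 0                ∎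
            where
            open mod-Reasoning m
            l₃ : ∀ T w S → T * w * S + + 1 * + 0 ≡ T * (w * S) + + 0
            l₃ = solve-∀
          σbʲ≅aᵗbʲ⁺ˡⁿ⁰ : φ K U 1 (powℤ b j) ≅ powℤ a t ∙ powℤ b (j + l * + n₀)
          σbʲ≅aᵗbʲ⁺ˡⁿ⁰ = begin
            φ K U 1 (powℤ b j)               ≈⟨ φ-cong (powℤ-b j) ⟩
            φ K U 1 (J , + 0)                ≈⟨ JK≡J₂ , a-exponent ⟩
            (J₂ , t * r^ J₂ + + 0)           ≈⟨ ∙-cong (powℤ-a t) (powℤ-b (j + l * + n₀)) ⟨
            powℤ a t ∙ powℤ b (j + l * + n₀) ∎
            where open ≅-Reasoning

        n₀∣⇒central : ∀ {x} k → x ≅ (k , + 0) → n₀ ∣ k → InCentre x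
        n₀∣⇒central {x} k x≅bᵏ n₀∣k g@(k′ , l) = ≅⇒≈ {x ∙ g} {g ∙ x} (begin
          x ∙ g                 ≈⟨ ∙-cong x≅bᵏ (≅-refl {g}) ⟩
          (k , + 0) ∙ (k′ , l)  ≈⟨ mod-reflexive (cong +_ (ℕP.+-comm k k′)) , a-exponent ⟩
          (k′ , l) ∙ (k , + 0)  ≈⟨ ∙-cong (≅-refl {g}) x≅bᵏ ⟨
          g ∙ x                 ∎)
          where
          open ≅-Reasoning
          a-exponent : + 0 * r^ k′ + l ≡ l * r^ k + + 0 [mod m ]
          a-exponent = mod-respˡ (sym (ℤP.+-identityˡ l)) (mod-sym
            (mod-respˡ (sym (ℤP.+-identityʳ (l * r^ k))) (mod-respʳ (ℤP.*-identityʳ l) (mod-*ˡ l (n₀∣⇒r^≡1 n₀∣k)))))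

        -- σ fixes b modulo n₀ (its b-exponent is 1 + l n₀), so b^i ↦ b^{-i} forces 2i ≡ 0 and hence i ≡ 0 (mod n₀).
        no-inverting-automorphism : ¬ 2 ∣ m ℕ.* n → ∀ i → ¬ InCentre (powℤ b i) →
                                    ¬ (∃ λ σ → IsAut σ × σ (powℤ b i) ≈ powℤ b (- i))
        no-inverting-automorphism odd i not-central (σ , σ-aut , σbⁱ≈b⁻ⁱ) =
          not-central (n₀∣⇒central I (powℤ-b i) (≡0⇒∣ (mod-trans (mod-∣ n₀∣n (mod-sym (mod-%ℕ n i))) i≡0)))
          where
          open AutomorphismShape σ-aut
          open HomProperties (IsAut.isHom σ-aut)
          I : ℕ
          I = i %ℕ n
          σb≅ : σ b ≅ (K , + t * r^ K + + 0)
          σb≅ = ≅-trans σb≅aᵗbᴷ (≅-reflexive (cong₂ _∙_ (pow-a t) (pow-b K)))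
          IK≡-i : + (I ℕ.* K) ≡ - i [mod n ]
          IK≡-i = mod-trans (proj₁ (begin
            (I ℕ.* K , _)                 ≡⟨ pow-≡ K (+ t * r^ K + + 0) I ⟨
            pow (K , + t * r^ K + + 0) I  ≈⟨ pow-cong I σb≅ ⟨
            pow (σ b) I                   ≈⟨ σ-pow b I ⟨
            σ (pow b I)                   ≈⟨ σ-cong (≅-trans (≅-reflexive (pow-b I)) (≅-sym (powℤ-b i))) ⟩
            σ (powℤ b i)                  ≈⟨ ≈⇒≅ {σ (powℤ b i)} {powℤ b (- i)} σbⁱ≈b⁻ⁱ ⟩
            powℤ b (- i)                  ≈⟨ powℤ-b (- i) ⟩
            ((- i) %ℕ n , + 0)            ∎)) (mod-sym (mod-%ℕ n (- i)))
            where open ≅-Reasoning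
          iK≡-i : i * + K ≡ - i [mod n₀ ]
          iK≡-i = mod-∣ n₀∣n (mod-trans (mod-*ʳ (+ K) (mod-%ℕ n i)) (mod-respˡ (ℤP.pos-* I K) IK≡-i))
          i2≡0 : i * + 2 ≡ + 0 [mod n₀ ]
          i2≡0 = begin
            i * + 2           ≡⟨ l i ⟩
            i * + 1 + i       ≈⟨ mod-+ (mod-*ˡ i K≡1) (mod-refl {x = i}) ⟨
            i * + K + i       ≈⟨ mod-+ iK≡-i (mod-refl {x = i}) ⟩
            - i + i           ≡⟨ ℤP.+-inverseˡ i ⟩
            + 0               ∎
            where
            open mod-Reasoning n₀
            l : ∀ i → i * + 2 ≡ i * + 1 + i
            l = solve-∀
          i≡0 : i ≡ + 0 [mod n₀ ]
          i≡0 = invertible-cancel-≡0 (odd⇒2-invertible-mod-n₀ odd) i2≡0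

open import Defs
open import Data.Nat using (ℕ; _≤_; _<_; _+_; _*_; _^_; _%_; _/_; NonZero)
open import Data.Nat.Divisibility using (_∣_)
open import Data.Nat.GCD using (gcd)
open import Data.Nat.Primality using (Prime)
open import Data.Integer as ℤ using (ℤ; +_; ∣_∣)
open import Data.Product using (Σ; ∃; _×_; _,_)
open import Relation.Nullary using (¬_)
open import Relation.Binary.PropositionalEquality using (_≡_)

lemma4p2 : (m n r n₀ : ℕ) .{{_ : NonZero m}} .{{_ : NonZero n}} .{{_ : NonZero n₀}} →
  let open Meta m n r in
  ¬ (2 ∣ order) →
  (∀ p → Prime p → ∀ H → IsSylow p H → IsCyclic H) →
  ¬ (r % m ≡ 1 % m) →
  (r ^ n) % m ≡ 1 % m →
  (r ^ n₀) % m ≡ 1 % m →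
  (∀ k → 1 ≤ k → (r ^ k) % m ≡ 1 % m → n₀ ≤ k) →
  NotDirectProduct →
  ((σ : Carrier → Carrier) →
    (IsAut σ →
      ∃ λ s → ∃ λ t → ∃ λ l →
        (1 ≤ s × s < m × gcd s m ≡ 1 × l < n / n₀ × 1 ≤ t × t ≤ m)
        × IsHom σ × σ a ≈ pow a s × σ b ≈ pow a t ∙ pow b (1 + l * n₀))
    × ((∃ λ s → ∃ λ t → ∃ λ l →
        (1 ≤ s × s < m × gcd s m ≡ 1 × l < n / n₀ × 1 ≤ t × t ≤ m)
        × IsHom σ × σ a ≈ pow a s × σ b ≈ pow a t ∙ pow b (1 + l * n₀))
      → IsAut σ))
  × (∀ (j t l : ℤ) → gcd ∣ j ∣ n ≡ 1 →
      ∃ λ σ → IsAut σ ×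
        σ (powℤ b j) ≈ powℤ a t ∙ powℤ b (j ℤ.+ l ℤ.* (+ n₀)))
  × (∀ (i : ℤ) → ¬ InCentre (powℤ b i) →
      ¬ (∃ λ σ → IsAut σ × σ (powℤ b i) ≈ powℤ b (ℤ.- i)))
lemma4p2 m n r n₀ odd sylow-cyclic r≢1 rⁿ≡1 rⁿ⁰≡1 minimal indecomposable =
  (λ σ → AutomorphismShape.hasStandardForm , hasStandardForm⇒isAut) ,
  ∃-aut[bʲ↦aᵗbʲ⁺ˡⁿ⁰] ,
  no-inverting-automorphism odd
  where
  open Congruence using (%ℕ≡⇒mod; mod⇒%ℕ≡)
  open Metacyclic m n r (%ℕ≡⇒mod m rⁿ≡1)
  open NonAbelian (λ r≡1 → r≢1 (mod⇒%ℕ≡ m r≡1))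
  open Indecomposable sylow-cyclic indecomposable
  open Order (%ℕ≡⇒mod m rⁿ⁰≡1) (λ k 1≤k rᵏ≡1 → minimal k 1≤k (mod⇒%ℕ≡ m rᵏ≡1))
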